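{- For every positive integer $N$, $$ e^{ -1} N^{ -1} I_0\!\left(2 \sqrt{\zeta_{N}(2)\,N}\right) \leq \sum_{n=0}^{N} p(n) \leq I_0\!\left(2 \sqrt{\zeta_{N}(2)\,N}\right). $$
   Context: $p(n)$ denotes the number of partitions of the non-negative integer $n$ (so $p(0)=1$ and $\sum_{n\ge0}p(n)z^n=\prod_{n\ge1}(1-z^n)^{ -1}$). $\zeta_N(s)=\sum_{n=1}^{N} n^{ -s}$ is the truncated zeta function. $I_\alpha$ is the modified Bessel function of the first kind, $I_{\alpha}(z)=\sum_{n=0}^{\infty}\frac{1}{n!\,\Gamma(n+\alpha+1)}\left(\frac{z}{2}\right)^{2n+\alpha}$. -}

module Defs where

open import Data.Nat as ℕ using (ℕ; zero; suc; _∸_; _≤ᵇ_)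
open import Data.Nat.Base using (_!)
open import Data.Nat.Properties using (m*n≢0; _!≢0)
open import Data.Bool using (if_then_else_)
open import Data.Integer using (+_)
open import Data.Rational using (ℚ; 0ℚ; 1ℚ; _+_; _*_; _/_)

sumℕ : ℕ → (ℕ → ℕ) → ℕ
sumℕ zero    f = 0
sumℕ (suc n) f = sumℕ n f ℕ.+ f n

sumℚ : ℕ → (ℕ → ℚ) → ℚ
sumℚ zero    f = 0ℚ
sumℚ (suc n) f = sumℚ n f + f n

_^ℚ_ : ℚ → ℕ → ℚ
x ^ℚ zero  = 1ℚ
x ^ℚ suc k = x * (x ^ℚ k)

ℕ→ℚ : ℕ → ℚ
ℕ→ℚ n = + n / 1

-- partsAtMost n m = number of partitions of n all of whose parts are ≤ m.
-- A partition of n with parts ≤ m+1 is determined by the multiplicity j of the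
-- part m+1 (with j*(m+1) ≤ n) together with a partition of n - j*(m+1)
-- with parts ≤ m.
partsAtMost : ℕ → ℕ → ℕ
partsAtMost zero    zero    = 1
partsAtMost (suc n) zero    = 0
partsAtMost n       (suc m) =
  sumℕ (suc n) (λ j → if (j ℕ.* suc m) ≤ᵇ n
                      then partsAtMost (n ∸ (j ℕ.* suc m)) m
                      else 0)

-- p(n): number of partitions of n (all parts are ≤ n); p 0 = 1.
p : ℕ → ℕ
p n = partsAtMost n n

partitionSum : ℕ → ℕ
partitionSum N = sumℕ (suc N) p

zetaN2 : ℕ → ℚ
zetaN2 N = sumℚ N (λ i → + 1 / (suc i ℕ.* suc i))

-- K-th partial sum of the series I₀(2√x) = Σ_{k≥0} x^k / (k!)²
-- (from the definition of I₀ with α = 0: (z/2)^{2k} = x^k when z = 2√x).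
besselI0Partial : ℚ → ℕ → ℚ
besselI0Partial x K = sumℚ K term
  where
  term : ℕ → ℚ
  term k = (x ^ℚ k) * (+ 1 / ((k !) ℕ.* (k !)))
    where instance _ = k !≢0
                   _ = m*n≢0 (k !) (k !)

ePartial : ℕ → ℚ
ePartial M = sumℚ M term
  where
  term : ℕ → ℚ
  term j = + 1 / (j !)
    where instance _ = j !≢0

{-# OPTIONS --safe #-}
module Submission where

-- Let A = Σ_{d,m ≤ N} z^(dm)/d and θ = z d/dz. Modulo z^(N+1) the generating function of
-- partitions with parts ≤ N is exp A, as both solve θF = θA·F with F(0) = 1. Hence
-- Σ_{n ≤ N} p(n) = Σ_k c_k/k!, where c_k sums the coefficients of z^0, …, z^N in A^k.
-- Multiplying by A turns coefficient sums behaving like M^k into Σ_{d,m} (M - dm)^k/d, which are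
-- Riemann sums of ∫ x^k dx; inductively c_k ≤ (ζ_N(2) N)^k/k!, which gives the upper bound.
-- Restoring the terms m = 0 of A, which add H_N, makes these Riemann sums bound the integral from
-- above, so the same estimate holds from below for (H_N + A)^k; and exp(H_N + A) = e^(H_N) exp A
-- with e^(H_N) ≤ e N.

open import Data.Nat as ℕ using (ℕ; zero; suc; NonZero; _!; z≤n; s≤s)
import Data.Nat.Properties as ℕP
open import Data.Nat.Induction using (<-rec)
import Data.Nat.Coprimality as Coprime
import Data.Integer as ℤ
import Data.Integer.Properties as ℤP
open import Data.Bool using (true; false; if_then_else_; T)
open import Data.Empty using (⊥-elim)
open import Data.Unit using (tt)
open import Data.Product using (_×_; _,_; ∃-syntax)
open import Data.Sum using (inj₁; inj₂)
open import Relation.Binary.PropositionalEquality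
open import Relation.Nullary using (yes; no; ¬_)
open import Defs

module RiemannSums where

  open import Data.Nat
  open import Data.Nat.Properties
  open import Data.Nat.Solver using (module +-*-Solver)
  open +-*-Solver using (solve; _:+_; _:*_; _:=_; con)

  binomial-lowerBound : ∀ k a c → suc k * c * a ^ k + a ^ suc k ≤ (a + c) ^ suc k
  binomial-lowerBound zero    a c =
    ≤-reflexive (solve 2 (λ a c → con 1 :* c :* con 1 :+ a :* con 1 := (a :+ c) :* con 1) refl a c)
  binomial-lowerBound (suc k) a c = begin
    suc (suc k) * c * (a * a ^ k) + a * (a * a ^ k)
      ≤⟨ m≤m+n _ (suc k * c * c * a ^ k) ⟩
    suc (suc k) * c * (a * a ^ k) + a * (a * a ^ k) + suc k * c * c * a ^ k
      ≡⟨ solve 4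
           (λ a c x k → (con 2 :+ k) :* c :* (a :* x) :+ a :* (a :* x) :+ (con 1 :+ k) :* c :* c :* x
                      := (a :+ c) :* ((con 1 :+ k) :* c :* x :+ a :* x))
           refl a c (a ^ k) k ⟩
    (a + c) * (suc k * c * a ^ k + a ^ suc k)
      ≤⟨ *-monoʳ-≤ (a + c) (binomial-lowerBound k a c) ⟩
    (a + c) * (a + c) ^ suc k ∎
    where open ≤-Reasoning

  binomial-upperBound : ∀ k a c → (a + c) ^ suc k ≤ suc k * c * (a + c) ^ k + a ^ suc k
  binomial-upperBound zero    a c =
    ≤-reflexive (solve 2 (λ a c → (a :+ c) :* con 1 := con 1 :* c :* con 1 :+ a :* con 1) refl a c)
  binomial-upperBound (suc k) a c = begin
    (a + c) * (a + c) ^ suc k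
      ≤⟨ *-monoʳ-≤ (a + c) (binomial-upperBound k a c) ⟩
    (a + c) * (suc k * c * y + a ^ suc k)
      ≡⟨ solve 5
           (λ a c x y k → (a :+ c) :* ((con 1 :+ k) :* c :* y :+ a :* x)
                        := (con 1 :+ k) :* c :* ((a :+ c) :* y) :+ a :* (a :* x) :+ c :* (a :* x))
           refl a c (a ^ k) y k ⟩
    suc k * c * Y + a * (a * a ^ k) + c * (a * a ^ k)
      ≤⟨ +-monoʳ-≤ (suc k * c * Y + a * (a * a ^ k)) (*-monoʳ-≤ c (^-monoˡ-≤ (suc k) (m≤m+n a c))) ⟩
    suc k * c * Y + a * (a * a ^ k) + c * Y
      ≡⟨ solve 5
           (λ a c x Y k → (con 1 :+ k) :* c :* Y :+ a :* (a :* x) :+ c :* Y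
                        := (con 2 :+ k) :* c :* Y :+ a :* (a :* x))
           refl a c (a ^ k) Y k ⟩
    suc (suc k) * c * Y + a * (a * a ^ k) ∎
    where
    open ≤-Reasoning
    y Y : ℕ
    y = (a + c) ^ k
    Y = (a + c) * y

  binomial-upperBound-∸ : ∀ k b c → b ^ suc k ≤ suc k * c * b ^ k + (b ∸ c) ^ suc k
  binomial-upperBound-∸ k b c with c ≤? b
  ... | yes c≤b = subst (λ x → x ^ suc k ≤ suc k * c * x ^ k + (b ∸ c) ^ suc k) (m∸n+n≡m c≤b)
                    (binomial-upperBound k (b ∸ c) c)
  ... | no c≰b = begin
    b * b ^ k                           ≤⟨ *-monoˡ-≤ (b ^ k) (<⇒≤ (≰⇒> c≰b)) ⟩
    c * b ^ k                           ≤⟨ *-monoˡ-≤ (b ^ k) (m≤n*m c (suc k)) ⟩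
    suc k * c * b ^ k                   ≤⟨ m≤m+n _ _ ⟩
    suc k * c * b ^ k + (b ∸ c) ^ suc k ∎
    where open ≤-Reasoning

  shiftℕ : ℕ → (ℕ → ℕ) → ℕ → ℕ
  shiftℕ zero    g n       = g n
  shiftℕ (suc c) g zero    = 0
  shiftℕ (suc c) g (suc n) = shiftℕ c g n

  shiftℕ-above : ∀ c g n → c ≤ n → shiftℕ c g n ≡ g (n ∸ c)
  shiftℕ-above zero    g n       _         = refl
  shiftℕ-above (suc c) g (suc n) (s≤s c≤n) = shiftℕ-above c g n c≤n

  shiftℕ-below : ∀ c g n → n < c → shiftℕ c g n ≡ 0
  shiftℕ-below (suc c) g zero    _         = refl
  shiftℕ-below (suc c) g (suc n) (s≤s n<c) = shiftℕ-below c g n n<c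

  ∸-+-swap : ∀ M x y → M ∸ (y + x) ≡ M ∸ x ∸ y
  ∸-+-swap M x y = trans (cong (M ∸_) (+-comm y x)) (sym (∸-+-assoc M x y))

  -- Riemann sums for ∫₀ᴹ x^k dx = M^(k+1)/(k+1) with mesh h: the strip
  -- [M - (E+1)h, M - E h] has area between h·(M - (E+1)h)^k and h·(M - E h)^k.
  riemannStep-lowerBound : ∀ k h E M →
    suc k * h * shiftℕ (suc E * h) (_^ k) M + (M ∸ suc E * h) ^ suc k ≤ (M ∸ E * h) ^ suc k
  riemannStep-lowerBound k h E M with suc E * h ≤? M
  ... | yes le = begin
    suc k * h * shiftℕ (suc E * h) (_^ k) M + (M ∸ suc E * h) ^ suc k
      ≡⟨ cong (λ x → suc k * h * x + (M ∸ suc E * h) ^ suc k) (shiftℕ-above (suc E * h) (_^ k) M le) ⟩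
    suc k * h * (M ∸ suc E * h) ^ k + (M ∸ suc E * h) ^ suc k
      ≡⟨ cong (λ x → suc k * h * x ^ k + x ^ suc k) (∸-+-swap M (E * h) h) ⟩
    suc k * h * (b ∸ h) ^ k + (b ∸ h) ^ suc k
      ≤⟨ binomial-lowerBound k (b ∸ h) h ⟩
    (b ∸ h + h) ^ suc k
      ≡⟨ cong (_^ suc k) (m∸n+n≡m h≤b) ⟩
    b ^ suc k ∎
    where
    open ≤-Reasoning
    b : ℕ
    b = M ∸ E * h
    h≤b : h ≤ b
    h≤b = subst (_≤ b) (m+n∸n≡m h (E * h)) (∸-monoˡ-≤ (E * h) le)
  ... | no nle = begin
    suc k * h * shiftℕ (suc E * h) (_^ k) M + (M ∸ suc E * h) ^ suc k
      ≡⟨ cong (λ x → suc k * h * x + (M ∸ suc E * h) ^ suc k) (shiftℕ-below (suc E * h) (_^ k) M (≰⇒> nle)) ⟩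
    suc k * h * 0 + (M ∸ suc E * h) ^ suc k
      ≡⟨ cong (_+ (M ∸ suc E * h) ^ suc k) (*-zeroʳ (suc k * h)) ⟩
    (M ∸ suc E * h) ^ suc k
      ≤⟨ ^-monoˡ-≤ (suc k) (∸-monoʳ-≤ M (m≤n+m (E * h) h)) ⟩
    (M ∸ E * h) ^ suc k ∎
    where open ≤-Reasoning

  riemannStep-upperBound : ∀ k h E M →
    (M ∸ E * h) ^ suc k ≤ suc k * h * shiftℕ (E * h) (_^ k) M + (M ∸ suc E * h) ^ suc k
  riemannStep-upperBound k h E M with E * h ≤? M
  ... | yes le = subst₂ (λ x y → (M ∸ E * h) ^ suc k ≤ suc k * h * x + y ^ suc k)
                   (sym (shiftℕ-above (E * h) (_^ k) M le)) (sym (∸-+-swap M (E * h) h))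
                   (binomial-upperBound-∸ k (M ∸ E * h) h)
  ... | no nle = subst (λ x → x ^ suc k ≤ suc k * h * shiftℕ (E * h) (_^ k) M + (M ∸ suc E * h) ^ suc k)
                   (sym (m≤n⇒m∸n≡0 (<⇒≤ (≰⇒> nle)))) z≤n

  riemannSum-lowerBound : ∀ k h E M →
    suc k * h * sumℕ E (λ e → shiftℕ (suc e * h) (_^ k) M) + (M ∸ E * h) ^ suc k ≤ M ^ suc k
  riemannSum-lowerBound k h zero    M = ≤-reflexive (cong (_+ M ^ suc k) (*-zeroʳ (suc k * h)))
  riemannSum-lowerBound k h (suc E) M = begin
    K * (ΣE + x) + (M ∸ suc E * h) ^ suc k
      ≡⟨ solve 4 (λ K S x y → K :* (S :+ x) :+ y := K :* S :+ (K :* x :+ y)) refl K ΣE x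
           ((M ∸ suc E * h) ^ suc k) ⟩
    K * ΣE + (K * x + (M ∸ suc E * h) ^ suc k)
      ≤⟨ +-monoʳ-≤ (K * ΣE) (riemannStep-lowerBound k h E M) ⟩
    K * ΣE + (M ∸ E * h) ^ suc k
      ≤⟨ riemannSum-lowerBound k h E M ⟩
    M ^ suc k ∎
    where
    open ≤-Reasoning
    K ΣE x : ℕ
    K = suc k * h
    ΣE = sumℕ E (λ e → shiftℕ (suc e * h) (_^ k) M)
    x = shiftℕ (suc E * h) (_^ k) M

  riemannSum-upperBound : ∀ k h E M →
    M ^ suc k ≤ suc k * h * sumℕ E (λ e → shiftℕ (e * h) (_^ k) M) + (M ∸ E * h) ^ suc k
  riemannSum-upperBound k h zero    M = ≤-reflexive (sym (cong (_+ M ^ suc k) (*-zeroʳ (suc k * h))))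
  riemannSum-upperBound k h (suc E) M = begin
    M ^ suc k
      ≤⟨ riemannSum-upperBound k h E M ⟩
    K * ΣE + (M ∸ E * h) ^ suc k
      ≤⟨ +-monoʳ-≤ (K * ΣE) (riemannStep-upperBound k h E M) ⟩
    K * ΣE + (K * x + (M ∸ suc E * h) ^ suc k)
      ≡⟨ solve 4 (λ K S x y → K :* S :+ (K :* x :+ y) := K :* (S :+ x) :+ y) refl K ΣE x
           ((M ∸ suc E * h) ^ suc k) ⟩
    K * (ΣE + x) + (M ∸ suc E * h) ^ suc k ∎
    where
    open ≤-Reasoning
    K ΣE x : ℕ
    K = suc k * h
    ΣE = sumℕ E (λ e → shiftℕ (e * h) (_^ k) M)
    x = shiftℕ (E * h) (_^ k) M

open RiemannSums
open import Data.Rational hiding (NonZero)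
open import Data.Rational.Properties
open import Data.Rational.Solver using (module +-*-Solver)
open +-*-Solver using (solve; _:+_; _:*_; _:=_; con)

ℕ→ℚ-as-mkℚ : ∀ n → ℕ→ℚ n ≡ mkℚ (ℤ.+ n) 0 (Coprime.sym (Coprime.1-coprimeTo n))
ℕ→ℚ-as-mkℚ n = normalize-coprime (Coprime.sym (Coprime.1-coprimeTo n))

ℕ→ℚ-homo-+ : ∀ m n → ℕ→ℚ (m ℕ.+ n) ≡ ℕ→ℚ m + ℕ→ℚ n
ℕ→ℚ-homo-+ m n = begin
  ℤ.+ (m ℕ.+ n) / 1                         ≡⟨ /-cong {q₁ = 1} {q₂ = 1} (sym m*1+n*1) refl ⟩
  (ℤ.+ m ℤ.* ℤ.+ 1 ℤ.+ ℤ.+ n ℤ.* ℤ.+ 1) / 1 ≡⟨ cong₂ _+_ (sym (ℕ→ℚ-as-mkℚ m)) (sym (ℕ→ℚ-as-mkℚ n)) ⟩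
  ℕ→ℚ m + ℕ→ℚ n                             ∎
  where
  open ≡-Reasoning
  m*1+n*1 : ℤ.+ m ℤ.* ℤ.+ 1 ℤ.+ ℤ.+ n ℤ.* ℤ.+ 1 ≡ ℤ.+ (m ℕ.+ n)
  m*1+n*1 = cong₂ ℤ._+_ (ℤP.*-identityʳ (ℤ.+ m)) (ℤP.*-identityʳ (ℤ.+ n))

ℕ→ℚ-homo-* : ∀ m n → ℕ→ℚ (m ℕ.* n) ≡ ℕ→ℚ m * ℕ→ℚ n
ℕ→ℚ-homo-* m n = begin
  ℤ.+ (m ℕ.* n) / 1     ≡⟨ /-cong {q₁ = 1} {q₂ = 1} (ℤP.pos-* m n) refl ⟩
  (ℤ.+ m ℤ.* ℤ.+ n) / 1 ≡⟨ cong₂ _*_ (sym (ℕ→ℚ-as-mkℚ m)) (sym (ℕ→ℚ-as-mkℚ n)) ⟩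
  ℕ→ℚ m * ℕ→ℚ n         ∎
  where open ≡-Reasoning

ℕ→ℚ-homo-^ : ∀ m k → ℕ→ℚ (m ℕ.^ k) ≡ ℕ→ℚ m ^ℚ k
ℕ→ℚ-homo-^ m zero    = refl
ℕ→ℚ-homo-^ m (suc k) = trans (ℕ→ℚ-homo-* m (m ℕ.^ k)) (cong (ℕ→ℚ m *_) (ℕ→ℚ-homo-^ m k))

ℕ→ℚ-homo-sumℕ : ∀ n f → ℕ→ℚ (sumℕ n f) ≡ sumℚ n (λ i → ℕ→ℚ (f i))
ℕ→ℚ-homo-sumℕ zero    f = refl
ℕ→ℚ-homo-sumℕ (suc n) f =
  trans (ℕ→ℚ-homo-+ (sumℕ n f) (f n)) (cong (_+ ℕ→ℚ (f n)) (ℕ→ℚ-homo-sumℕ n f))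

ℕ→ℚ-nonNeg : ∀ n → 0ℚ ≤ ℕ→ℚ n
ℕ→ℚ-nonNeg n = nonNegative⁻¹ (ℕ→ℚ n) {{normalize-nonNeg n 1}}

p≤p+q : ∀ {p q} → 0ℚ ≤ q → p ≤ p + q
p≤p+q {p} q≥0 = ≤-trans (≤-reflexive (sym (+-identityʳ p))) (+-monoʳ-≤ p q≥0)

ℕ→ℚ-mono-≤ : ∀ {m n} → m ℕ.≤ n → ℕ→ℚ m ≤ ℕ→ℚ n
ℕ→ℚ-mono-≤ {m} {n} m≤n = subst (ℕ→ℚ m ≤_) m+[n∸m]≡n (p≤p+q (ℕ→ℚ-nonNeg (n ℕ.∸ m)))
  where
  m+[n∸m]≡n : ℕ→ℚ m + ℕ→ℚ (n ℕ.∸ m) ≡ ℕ→ℚ n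
  m+[n∸m]≡n = trans (sym (ℕ→ℚ-homo-+ m (n ℕ.∸ m))) (cong ℕ→ℚ (ℕP.m+[n∸m]≡n m≤n))

*-nonNeg : ∀ {p q} → 0ℚ ≤ p → 0ℚ ≤ q → 0ℚ ≤ p * q
*-nonNeg {p} {q} p≥0 q≥0 = nonNegative⁻¹ (p * q)
  {{nonNeg*nonNeg⇒nonNeg p {{nonNegative p≥0}} q {{nonNegative q≥0}}}}

^ℚ-nonNeg : ∀ {x} k → 0ℚ ≤ x → 0ℚ ≤ x ^ℚ k
^ℚ-nonNeg zero    x≥0 = ℕ→ℚ-nonNeg 1
^ℚ-nonNeg (suc k) x≥0 = *-nonNeg x≥0 (^ℚ-nonNeg k x≥0)

^ℚ-distrib-* : ∀ x y k → (x * y) ^ℚ k ≡ x ^ℚ k * y ^ℚ k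
^ℚ-distrib-* x y zero    = refl
^ℚ-distrib-* x y (suc k) = trans (cong (x * y *_) (^ℚ-distrib-* x y k))
  (solve 4 (λ a b c d → a :* b :* (c :* d) := a :* c :* (b :* d)) refl x y (x ^ℚ k) (y ^ℚ k))

1^ℚ : ∀ k → 1ℚ ^ℚ k ≡ 1ℚ
1^ℚ zero    = refl
1^ℚ (suc k) = trans (*-identityˡ _) (1^ℚ k)

*-monoˡ-≤-0≤ : ∀ {r p q} → 0ℚ ≤ r → p ≤ q → r * p ≤ r * q
*-monoˡ-≤-0≤ {r} r≥0 = *-monoˡ-≤-nonNeg r {{nonNegative r≥0}}

*-monoʳ-≤-0≤ : ∀ {r p q} → 0ℚ ≤ r → p ≤ q → p * r ≤ q * r
*-monoʳ-≤-0≤ {r} r≥0 = *-monoʳ-≤-nonNeg r {{nonNegative r≥0}}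

*-mono-≤-0≤ : ∀ {a b c d} → 0ℚ ≤ a → 0ℚ ≤ d → a ≤ b → c ≤ d → a * c ≤ b * d
*-mono-≤-0≤ a≥0 d≥0 a≤b c≤d = ≤-trans (*-monoˡ-≤-0≤ a≥0 c≤d) (*-monoʳ-≤-0≤ d≥0 a≤b)

recip : (n : ℕ) → .{{NonZero n}} → ℚ
recip n = ℤ.+ 1 / n

recip-nonNeg : ∀ n .{{_ : NonZero n}} → 0ℚ ≤ recip n
recip-nonNeg n = nonNegative⁻¹ (recip n) {{normalize-nonNeg 1 n}}

recip-inverseˡ : ∀ n .{{_ : NonZero n}} → recip n * ℕ→ℚ n ≡ 1ℚ
recip-inverseˡ (suc n) = begin
  recip (suc n) * ℕ→ℚ (suc n)
    ≡⟨ cong₂ _*_ (normalize-coprime (Coprime.1-coprimeTo (suc n))) (ℕ→ℚ-as-mkℚ (suc n)) ⟩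
  1/ n+1 * n+1
    ≡⟨ *-inverseˡ n+1 ⟩
  1ℚ ∎
  where
  open ≡-Reasoning
  n+1 : ℚ
  n+1 = mkℚ (ℤ.+ suc n) 0 (Coprime.sym (Coprime.1-coprimeTo (suc n)))

recip-inverseʳ : ∀ n .{{_ : NonZero n}} → ℕ→ℚ n * recip n ≡ 1ℚ
recip-inverseʳ n = trans (*-comm (ℕ→ℚ n) (recip n)) (recip-inverseˡ n)

ℕ→ℚ-*-cancelˡ : ∀ n .{{_ : NonZero n}} {x y} → ℕ→ℚ n * x ≡ ℕ→ℚ n * y → x ≡ y
ℕ→ℚ-*-cancelˡ n {x} {y} eq = begin
  x                     ≡⟨ sym (unscale x) ⟩
  recip n * (ℕ→ℚ n * x) ≡⟨ cong (recip n *_) eq ⟩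
  recip n * (ℕ→ℚ n * y) ≡⟨ unscale y ⟩
  y                     ∎
  where
  open ≡-Reasoning
  unscale : ∀ z → recip n * (ℕ→ℚ n * z) ≡ z
  unscale z = trans (sym (*-assoc (recip n) (ℕ→ℚ n) z))
    (trans (cong (_* z) (recip-inverseˡ n)) (*-identityˡ z))

recip-homo-* : ∀ m n .{{_ : NonZero m}} .{{_ : NonZero n}} →
  recip (m ℕ.* n) {{ℕP.m*n≢0 m n}} ≡ recip m * recip n
recip-homo-* m n = ℕ→ℚ-*-cancelˡ (m ℕ.* n) {{ℕP.m*n≢0 m n}} (begin
  ℕ→ℚ (m ℕ.* n) * recip (m ℕ.* n) {{ℕP.m*n≢0 m n}}
    ≡⟨ recip-inverseʳ (m ℕ.* n) {{ℕP.m*n≢0 m n}} ⟩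
  1ℚ
    ≡⟨ sym (cong₂ _*_ (recip-inverseʳ m) (recip-inverseʳ n)) ⟩
  (ℕ→ℚ m * recip m) * (ℕ→ℚ n * recip n)
    ≡⟨ solve 4 (λ a b c d → a :* b :* (c :* d) := a :* c :* (b :* d)) refl (ℕ→ℚ m) (recip m) (ℕ→ℚ n) (recip n) ⟩
  ℕ→ℚ m * ℕ→ℚ n * (recip m * recip n)
    ≡⟨ cong (_* (recip m * recip n)) (sym (ℕ→ℚ-homo-* m n)) ⟩
  ℕ→ℚ (m ℕ.* n) * (recip m * recip n) ∎)
  where open ≡-Reasoning

recip-*-ℕ→ℚ : ∀ m n .{{_ : NonZero m}} → recip m * ℕ→ℚ (m ℕ.* n) ≡ ℕ→ℚ n
recip-*-ℕ→ℚ m n = begin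
  recip m * ℕ→ℚ (m ℕ.* n)   ≡⟨ cong (recip m *_) (ℕ→ℚ-homo-* m n) ⟩
  recip m * (ℕ→ℚ m * ℕ→ℚ n) ≡⟨ sym (*-assoc (recip m) (ℕ→ℚ m) (ℕ→ℚ n)) ⟩
  recip m * ℕ→ℚ m * ℕ→ℚ n   ≡⟨ cong (_* ℕ→ℚ n) (recip-inverseˡ m) ⟩
  1ℚ * ℕ→ℚ n                ≡⟨ *-identityˡ (ℕ→ℚ n) ⟩
  ℕ→ℚ n                     ∎
  where open ≡-Reasoning

invFact : ℕ → ℚ
invFact k = recip (k !) {{k ℕP.!≢0}}

invFact-nonNeg : ∀ k → 0ℚ ≤ invFact k
invFact-nonNeg k = recip-nonNeg (k !) {{k ℕP.!≢0}}

invFact-suc : ∀ k → ℕ→ℚ (suc k) * invFact (suc k) ≡ invFact k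
invFact-suc k = begin
  ℕ→ℚ (suc k) * invFact (suc k)             ≡⟨ cong (ℕ→ℚ (suc k) *_) (recip-homo-* (suc k) (k !) {{_}} {{k ℕP.!≢0}}) ⟩
  ℕ→ℚ (suc k) * (recip (suc k) * invFact k) ≡⟨ sym (*-assoc (ℕ→ℚ (suc k)) (recip (suc k)) (invFact k)) ⟩
  ℕ→ℚ (suc k) * recip (suc k) * invFact k   ≡⟨ cong (_* invFact k) (recip-inverseʳ (suc k)) ⟩
  1ℚ * invFact k                            ≡⟨ *-identityˡ (invFact k) ⟩
  invFact k                                 ∎
  where open ≡-Reasoning

invFact≤1 : ∀ k → invFact k ≤ 1ℚ
invFact≤1 k = begin
  invFact k             ≡⟨ sym (*-identityʳ (invFact k)) ⟩
  invFact k * 1ℚ        ≤⟨ *-monoˡ-≤-0≤ (invFact-nonNeg k) (ℕ→ℚ-mono-≤ 1≤k!) ⟩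
  invFact k * ℕ→ℚ (k !) ≡⟨ recip-inverseˡ (k !) {{k ℕP.!≢0}} ⟩
  1ℚ                    ∎
  where
  open ≤-Reasoning
  1≤k! : 1 ℕ.≤ k !
  1≤k! = ℕ.>-nonZero⁻¹ (k !) {{k ℕP.!≢0}}

sumℚ-cong-< : ∀ n {f g : ℕ → ℚ} → (∀ i → i ℕ.< n → f i ≡ g i) → sumℚ n f ≡ sumℚ n g
sumℚ-cong-< zero    eq = refl
sumℚ-cong-< (suc n) eq = cong₂ _+_ (sumℚ-cong-< n (λ i i<n → eq i (ℕP.m<n⇒m<1+n i<n))) (eq n ℕP.≤-refl)

sumℚ-cong : ∀ n {f g : ℕ → ℚ} → (∀ i → f i ≡ g i) → sumℚ n f ≡ sumℚ n g
sumℚ-cong n eq = sumℚ-cong-< n (λ i _ → eq i)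

sumℚ-zero : ∀ n {f : ℕ → ℚ} → (∀ i → i ℕ.< n → f i ≡ 0ℚ) → sumℚ n f ≡ 0ℚ
sumℚ-zero zero    eq = refl
sumℚ-zero (suc n) eq = trans (cong₂ _+_ (sumℚ-zero n (λ i i<n → eq i (ℕP.m<n⇒m<1+n i<n))) (eq n ℕP.≤-refl))
  (+-identityˡ 0ℚ)

sumℚ-distrib-+ : ∀ n (f g : ℕ → ℚ) → sumℚ n (λ i → f i + g i) ≡ sumℚ n f + sumℚ n g
sumℚ-distrib-+ zero    f g = refl
sumℚ-distrib-+ (suc n) f g = trans (cong (_+ (f n + g n)) (sumℚ-distrib-+ n f g))
  (solve 4 (λ a b c d → (a :+ b) :+ (c :+ d) := (a :+ c) :+ (b :+ d)) refl (sumℚ n f) (sumℚ n g) (f n) (g n))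

*-distribˡ-sumℚ : ∀ n c (f : ℕ → ℚ) → c * sumℚ n f ≡ sumℚ n (λ i → c * f i)
*-distribˡ-sumℚ zero    c f = *-zeroʳ c
*-distribˡ-sumℚ (suc n) c f =
  trans (*-distribˡ-+ c (sumℚ n f) (f n)) (cong (_+ c * f n) (*-distribˡ-sumℚ n c f))

*-distribʳ-sumℚ : ∀ n c (f : ℕ → ℚ) → sumℚ n f * c ≡ sumℚ n (λ i → f i * c)
*-distribʳ-sumℚ n c f =
  trans (*-comm (sumℚ n f) c) (trans (*-distribˡ-sumℚ n c f) (sumℚ-cong n (λ i → *-comm c (f i))))

sumℚ-suc : ∀ n (f : ℕ → ℚ) → sumℚ (suc n) f ≡ f 0 + sumℚ n (λ i → f (suc i))
sumℚ-suc zero    f = trans (+-identityˡ (f 0)) (sym (+-identityʳ (f 0)))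
sumℚ-suc (suc n) f = trans (cong (_+ f (suc n)) (sumℚ-suc n f)) (+-assoc (f 0) _ _)

sumℚ-comm : ∀ m n (f : ℕ → ℕ → ℚ) →
  sumℚ m (λ i → sumℚ n (λ j → f i j)) ≡ sumℚ n (λ j → sumℚ m (λ i → f i j))
sumℚ-comm zero    n f = sym (sumℚ-zero n (λ _ _ → refl))
sumℚ-comm (suc m) n f = trans (cong (_+ sumℚ n (f m)) (sumℚ-comm m n f))
  (sym (sumℚ-distrib-+ n (λ j → sumℚ m (λ i → f i j)) (f m)))

sumℚ-mono-≤ : ∀ n {f g : ℕ → ℚ} → (∀ i → i ℕ.< n → f i ≤ g i) → sumℚ n f ≤ sumℚ n g
sumℚ-mono-≤ zero    le = ≤-refl
sumℚ-mono-≤ (suc n) le = +-mono-≤ (sumℚ-mono-≤ n (λ i i<n → le i (ℕP.m<n⇒m<1+n i<n))) (le n ℕP.≤-refl)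

sumℚ-nonNeg : ∀ n {f : ℕ → ℚ} → (∀ i → i ℕ.< n → 0ℚ ≤ f i) → 0ℚ ≤ sumℚ n f
sumℚ-nonNeg n {f} le = subst (_≤ sumℚ n f) (sumℚ-zero n (λ _ _ → refl)) (sumℚ-mono-≤ n le)

sumℚ-+-length : ∀ m k (f : ℕ → ℚ) → sumℚ (k ℕ.+ m) f ≡ sumℚ m f + sumℚ k (λ i → f (m ℕ.+ i))
sumℚ-+-length m zero    f = sym (+-identityʳ (sumℚ m f))
sumℚ-+-length m (suc k) f = begin
  sumℚ (k ℕ.+ m) f + f (k ℕ.+ m)
    ≡⟨ cong₂ _+_ (sumℚ-+-length m k f) (cong f (ℕP.+-comm k m)) ⟩
  sumℚ m f + sumℚ k (λ i → f (m ℕ.+ i)) + f (m ℕ.+ k)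
    ≡⟨ +-assoc (sumℚ m f) _ _ ⟩
  sumℚ m f + sumℚ (suc k) (λ i → f (m ℕ.+ i)) ∎
  where open ≡-Reasoning

sumℚ-zero-tail : ∀ m n {f : ℕ → ℚ} → m ℕ.≤ n → (∀ i → m ℕ.≤ i → f i ≡ 0ℚ) → sumℚ n f ≡ sumℚ m f
sumℚ-zero-tail m n {f} m≤n tail = begin
  sumℚ n f
    ≡⟨ cong (λ k → sumℚ k f) (sym (ℕP.m∸n+n≡m m≤n)) ⟩
  sumℚ (n ℕ.∸ m ℕ.+ m) f
    ≡⟨ sumℚ-+-length m (n ℕ.∸ m) f ⟩
  sumℚ m f + sumℚ (n ℕ.∸ m) (λ i → f (m ℕ.+ i))
    ≡⟨ cong (sumℚ m f +_) (sumℚ-zero (n ℕ.∸ m) (λ i _ → tail (m ℕ.+ i) (ℕP.m≤m+n m i))) ⟩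
  sumℚ m f + 0ℚ
    ≡⟨ +-identityʳ (sumℚ m f) ⟩
  sumℚ m f ∎
  where open ≡-Reasoning

sumℚ-mono-length : ∀ m n {f : ℕ → ℚ} → m ℕ.≤ n → (∀ i → 0ℚ ≤ f i) → sumℚ m f ≤ sumℚ n f
sumℚ-mono-length m n {f} m≤n f≥0 = begin
  sumℚ m f                                      ≤⟨ p≤p+q (sumℚ-nonNeg (n ℕ.∸ m) (λ i _ → f≥0 (m ℕ.+ i))) ⟩
  sumℚ m f + sumℚ (n ℕ.∸ m) (λ i → f (m ℕ.+ i)) ≡⟨ sym (sumℚ-+-length m (n ℕ.∸ m) f) ⟩
  sumℚ (n ℕ.∸ m ℕ.+ m) f                        ≡⟨ cong (λ k → sumℚ k f) (ℕP.m∸n+n≡m m≤n) ⟩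
  sumℚ n f                                      ∎
  where open ≤-Reasoning

sumℚ-reverse : ∀ n (f : ℕ → ℚ) → sumℚ n f ≡ sumℚ n (λ i → f (n ℕ.∸ suc i))
sumℚ-reverse zero    f = refl
sumℚ-reverse (suc n) f = begin
  sumℚ n f + f n                       ≡⟨ cong (_+ f n) (sumℚ-reverse n f) ⟩
  sumℚ n (λ i → f (n ℕ.∸ suc i)) + f n ≡⟨ +-comm _ (f n) ⟩
  f n + sumℚ n (λ i → f (n ℕ.∸ suc i)) ≡⟨ sym (sumℚ-suc n (λ i → f (n ℕ.∸ i))) ⟩
  sumℚ (suc n) (λ i → f (n ℕ.∸ i))     ∎
  where open ≡-Reasoning

sumℚ-triangle : ∀ M (F : ℕ → ℕ → ℚ) →
  sumℚ (suc M) (λ n → sumℚ (suc n) (λ i → F i (n ℕ.∸ i))) ≡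
  sumℚ (suc M) (λ i → sumℚ (suc (M ℕ.∸ i)) (F i))
sumℚ-triangle zero    F = refl
sumℚ-triangle (suc M) F = begin
  byDiagonal M + diagonal
    ≡⟨ cong (_+ diagonal) (sumℚ-triangle M F) ⟩
  byRow M + (sumℚ (suc M) (λ i → F i (suc M ℕ.∸ i)) + F (suc M) (M ℕ.∸ M))
    ≡⟨ cong (λ j → byRow M + (sumℚ (suc M) (λ i → F i (suc M ℕ.∸ i)) + F (suc M) j)) (ℕP.n∸n≡0 M) ⟩
  byRow M + (sumℚ (suc M) (λ i → F i (suc M ℕ.∸ i)) + F (suc M) 0)
    ≡⟨ sym (+-assoc (byRow M) _ _) ⟩
  byRow M + sumℚ (suc M) (λ i → F i (suc M ℕ.∸ i)) + F (suc M) 0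
    ≡⟨ cong (_+ F (suc M) 0) (sym (sumℚ-distrib-+ (suc M) _ _)) ⟩
  sumℚ (suc M) (λ i → sumℚ (suc (M ℕ.∸ i)) (F i) + F i (suc M ℕ.∸ i)) + F (suc M) 0
    ≡⟨ cong₂ _+_ (sumℚ-cong-< (suc M) extendRow) lastRow ⟩
  byRow (suc M) ∎
  where
  open ≡-Reasoning
  byDiagonal byRow : ℕ → ℚ
  byDiagonal M = sumℚ (suc M) (λ n → sumℚ (suc n) (λ i → F i (n ℕ.∸ i)))
  byRow M = sumℚ (suc M) (λ i → sumℚ (suc (M ℕ.∸ i)) (F i))
  diagonal : ℚ
  diagonal = sumℚ (suc (suc M)) (λ i → F i (suc M ℕ.∸ i))
  extendRow : ∀ i → i ℕ.< suc M →
    sumℚ (suc (M ℕ.∸ i)) (F i) + F i (suc M ℕ.∸ i) ≡ sumℚ (suc (suc M ℕ.∸ i)) (F i)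
  extendRow i (s≤s i≤M) rewrite ℕP.+-∸-assoc 1 i≤M = refl
  lastRow : F (suc M) 0 ≡ sumℚ (suc (suc M ℕ.∸ suc M)) (F (suc M))
  lastRow rewrite ℕP.n∸n≡0 M = sym (+-identityˡ _)

sumℚ-convolution-≤ : ∀ K (f g : ℕ → ℚ) → (∀ i → 0ℚ ≤ f i) → (∀ i → 0ℚ ≤ g i) →
  sumℚ K (λ n → sumℚ (suc n) (λ k → f (n ℕ.∸ k) * g k)) ≤ sumℚ K f * sumℚ K g
sumℚ-convolution-≤ zero    f g f≥0 g≥0 = ≤-refl
sumℚ-convolution-≤ (suc M) f g f≥0 g≥0 = begin
  sumℚ (suc M) (λ n → sumℚ (suc n) (λ k → f (n ℕ.∸ k) * g k))
    ≡⟨ sumℚ-cong (suc M) (λ n → sumℚ-cong (suc n) (λ k → *-comm (f (n ℕ.∸ k)) (g k))) ⟩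
  sumℚ (suc M) (λ n → sumℚ (suc n) (λ k → g k * f (n ℕ.∸ k)))
    ≡⟨ sumℚ-triangle M (λ k i → g k * f i) ⟩
  sumℚ (suc M) (λ k → sumℚ (suc (M ℕ.∸ k)) (λ i → g k * f i))
    ≡⟨ sumℚ-cong (suc M) (λ k → sym (*-distribˡ-sumℚ (suc (M ℕ.∸ k)) (g k) f)) ⟩
  sumℚ (suc M) (λ k → g k * sumℚ (suc (M ℕ.∸ k)) f)
    ≤⟨ sumℚ-mono-≤ (suc M)
         (λ k _ → *-monoˡ-≤-0≤ (g≥0 k) (sumℚ-mono-length (suc (M ℕ.∸ k)) (suc M) (s≤s (ℕP.m∸n≤m M k)) f≥0)) ⟩
  sumℚ (suc M) (λ k → g k * sumℚ (suc M) f)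
    ≡⟨ sym (*-distribʳ-sumℚ (suc M) (sumℚ (suc M) f) g) ⟩
  sumℚ (suc M) g * sumℚ (suc M) f
    ≡⟨ *-comm (sumℚ (suc M) g) (sumℚ (suc M) f) ⟩
  sumℚ (suc M) f * sumℚ (suc M) g ∎
  where open ≤-Reasoning

-- Formal power series

Series : Set
Series = ℕ → ℚ

infixl 6 _⊕_
infixr 8 _·_
infixl 7 _⋆_
infixr 9 _⋆^_
infix  4 _≡[≤_]_

_⊕_ : Series → Series → Series
(a ⊕ b) n = a n + b n

_·_ : ℚ → Series → Series
(c · a) n = c * a n

_⋆_ : Series → Series → Series
(a ⋆ b) n = sumℚ (suc n) (λ i → a i * b (n ℕ.∸ i))

monomial : ℕ → Series
monomial zero    zero    = 1ℚ
monomial zero    (suc n) = 0ℚ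
monomial (suc j) zero    = 0ℚ
monomial (suc j) (suc n) = monomial j n

_⋆^_ : Series → ℕ → Series
a ⋆^ zero  = monomial 0
a ⋆^ suc k = a ⋆ a ⋆^ k

shift : ℕ → Series → Series
shift zero    f n       = f n
shift (suc c) f zero    = 0ℚ
shift (suc c) f (suc n) = shift c f n

θ : Series → Series
θ f n = ℕ→ℚ n * f n

_≡[≤_]_ : Series → ℕ → Series → Set
f ≡[≤ N ] g = ∀ n → n ℕ.≤ N → f n ≡ g n

⋆-congˡ : ∀ {a a′} b n → a ≡[≤ n ] a′ → (a ⋆ b) n ≡ (a′ ⋆ b) n
⋆-congˡ b n eq = sumℚ-cong-< (suc n) (λ i i≤n → cong (_* b (n ℕ.∸ i)) (eq i (ℕP.≤-pred i≤n)))

⋆-congʳ : ∀ a {b b′} n → b ≡[≤ n ] b′ → (a ⋆ b) n ≡ (a ⋆ b′) n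
⋆-congʳ a n eq = sumℚ-cong (suc n) (λ i → cong (a i *_) (eq (n ℕ.∸ i) (ℕP.m∸n≤m n i)))

⋆-comm : ∀ a b → a ⋆ b ≗ b ⋆ a
⋆-comm a b n = trans (sumℚ-reverse (suc n) (λ i → a i * b (n ℕ.∸ i)))
  (sumℚ-cong-< (suc n) (λ i i≤n → trans
    (cong (λ j → a (n ℕ.∸ i) * b j) (ℕP.m∸[m∸n]≡n (ℕP.≤-pred i≤n))) (*-comm (a (n ℕ.∸ i)) (b i))))

⋆-assoc : ∀ a b c → (a ⋆ b) ⋆ c ≗ a ⋆ (b ⋆ c)
⋆-assoc a b c n = begin
  sumℚ (suc n) (λ l → sumℚ (suc l) (λ i → a i * b (l ℕ.∸ i)) * c (n ℕ.∸ l))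
    ≡⟨ sumℚ-cong (suc n) (λ l → *-distribʳ-sumℚ (suc l) (c (n ℕ.∸ l)) (λ i → a i * b (l ℕ.∸ i))) ⟩
  sumℚ (suc n) (λ l → sumℚ (suc l) (λ i → a i * b (l ℕ.∸ i) * c (n ℕ.∸ l)))
    ≡⟨ sumℚ-cong (suc n) (λ l → sumℚ-cong-< (suc l) (λ i i≤l →
         cong (λ j → a i * b (l ℕ.∸ i) * c (n ℕ.∸ j)) (sym (ℕP.m+[n∸m]≡n (ℕP.≤-pred i≤l))))) ⟩
  sumℚ (suc n) (λ l → sumℚ (suc l) (λ i → F i (l ℕ.∸ i)))
    ≡⟨ sumℚ-triangle n F ⟩
  sumℚ (suc n) (λ i → sumℚ (suc (n ℕ.∸ i)) (F i))
    ≡⟨ sumℚ-cong (suc n)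
         (λ i → trans (sumℚ-cong (suc (n ℕ.∸ i)) (reassociate i)) (sym (*-distribˡ-sumℚ (suc (n ℕ.∸ i)) (a i) _))) ⟩
  sumℚ (suc n) (λ i → a i * (b ⋆ c) (n ℕ.∸ i)) ∎
  where
  open ≡-Reasoning
  F : ℕ → ℕ → ℚ
  F i j = a i * b j * c (n ℕ.∸ (i ℕ.+ j))
  reassociate : ∀ i j → F i j ≡ a i * (b j * c (n ℕ.∸ i ℕ.∸ j))
  reassociate i j = trans (*-assoc (a i) (b j) _) (cong (λ k → a i * (b j * c k)) (sym (ℕP.∸-+-assoc n i j)))

⋆-leftComm : ∀ a b c → a ⋆ (b ⋆ c) ≗ b ⋆ (a ⋆ c)
⋆-leftComm a b c n = begin
  (a ⋆ (b ⋆ c)) n ≡⟨ sym (⋆-assoc a b c n) ⟩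
  ((a ⋆ b) ⋆ c) n ≡⟨ ⋆-congˡ c n (λ m _ → ⋆-comm a b m) ⟩
  ((b ⋆ a) ⋆ c) n ≡⟨ ⋆-assoc b a c n ⟩
  (b ⋆ (a ⋆ c)) n ∎
  where open ≡-Reasoning

⋆-distribˡ-⊕ : ∀ a b c → a ⋆ (b ⊕ c) ≗ a ⋆ b ⊕ a ⋆ c
⋆-distribˡ-⊕ a b c n =
  trans (sumℚ-cong (suc n) (λ i → *-distribˡ-+ (a i) _ _)) (sumℚ-distrib-+ (suc n) _ _)

⋆-distribʳ-⊕ : ∀ a b c → (a ⊕ b) ⋆ c ≗ a ⋆ c ⊕ b ⋆ c
⋆-distribʳ-⊕ a b c n =
  trans (sumℚ-cong (suc n) (λ i → *-distribʳ-+ (c (n ℕ.∸ i)) (a i) (b i))) (sumℚ-distrib-+ (suc n) _ _)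

⋆-·ˡ : ∀ k a b → (k · a) ⋆ b ≗ k · (a ⋆ b)
⋆-·ˡ k a b n = trans (sumℚ-cong (suc n) (λ i → *-assoc k (a i) _)) (sym (*-distribˡ-sumℚ (suc n) k _))

⋆-·ʳ : ∀ a k b → a ⋆ (k · b) ≗ k · (a ⋆ b)
⋆-·ʳ a k b n = trans (sumℚ-cong (suc n) (λ i → solve 3 (λ x y z → x :* (y :* z) := y :* (x :* z)) refl (a i) k _))
  (sym (*-distribˡ-sumℚ (suc n) k _))

⋆-sumʳ : ∀ a K (B : ℕ → Series) n → (a ⋆ (λ m → sumℚ K (λ k → B k m))) n ≡ sumℚ K (λ k → (a ⋆ B k) n)
⋆-sumʳ a K B n = trans (sumℚ-cong (suc n) (λ i → *-distribˡ-sumℚ K (a i) _)) (sumℚ-comm (suc n) K _)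

⋆-sumˡ : ∀ K (B : ℕ → Series) a n → ((λ m → sumℚ K (λ k → B k m)) ⋆ a) n ≡ sumℚ K (λ k → (B k ⋆ a) n)
⋆-sumˡ K B a n = trans (sumℚ-cong (suc n) (λ i → *-distribʳ-sumℚ K (a (n ℕ.∸ i)) _)) (sumℚ-comm (suc n) K _)

⋆-nonNeg : ∀ a b → (∀ m → 0ℚ ≤ a m) → (∀ m → 0ℚ ≤ b m) → ∀ n → 0ℚ ≤ (a ⋆ b) n
⋆-nonNeg a b a≥0 b≥0 n = sumℚ-nonNeg (suc n) (λ i _ → *-nonNeg (a≥0 i) (b≥0 (n ℕ.∸ i)))

⋆-monoʳ-≤ : ∀ a {f g} n → (∀ m → 0ℚ ≤ a m) → (∀ m → m ℕ.≤ n → f m ≤ g m) → (a ⋆ f) n ≤ (a ⋆ g) n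
⋆-monoʳ-≤ a n a≥0 f≤g = sumℚ-mono-≤ (suc n) (λ i _ →
  *-monoˡ-≤-0≤ (a≥0 i) (f≤g (n ℕ.∸ i) (ℕP.m∸n≤m n i)))

⋆-zeroʳ : ∀ a b n → b ≡[≤ n ] (λ _ → 0ℚ) → (a ⋆ b) n ≡ 0ℚ
⋆-zeroʳ a b n b≡0 = sumℚ-zero (suc n) (λ i _ →
  trans (cong (a i *_) (b≡0 (n ℕ.∸ i) (ℕP.m∸n≤m n i))) (*-zeroʳ (a i)))

monomial-⋆ : ∀ j f → monomial j ⋆ f ≗ shift j f
monomial-⋆ zero    f zero    = trans (+-identityˡ _) (*-identityˡ (f 0))
monomial-⋆ zero    f (suc n) = begin
  (monomial 0 ⋆ f) (suc n)
    ≡⟨ sumℚ-suc (suc n) _ ⟩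
  1ℚ * f (suc n) + sumℚ (suc n) (λ i → 0ℚ * f (n ℕ.∸ i))
    ≡⟨ cong (1ℚ * f (suc n) +_) (sumℚ-zero (suc n) (λ i _ → *-zeroˡ (f (n ℕ.∸ i)))) ⟩
  1ℚ * f (suc n) + 0ℚ
    ≡⟨ trans (+-identityʳ _) (*-identityˡ (f (suc n))) ⟩
  f (suc n) ∎
  where open ≡-Reasoning
monomial-⋆ (suc j) f zero    = trans (+-identityˡ _) (*-zeroˡ (f 0))
monomial-⋆ (suc j) f (suc n) = begin
  (monomial (suc j) ⋆ f) (suc n)      ≡⟨ sumℚ-suc (suc n) _ ⟩
  0ℚ * f (suc n) + (monomial j ⋆ f) n ≡⟨ cong (_+ (monomial j ⋆ f) n) (*-zeroˡ (f (suc n))) ⟩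
  0ℚ + (monomial j ⋆ f) n             ≡⟨ +-identityˡ _ ⟩
  (monomial j ⋆ f) n                  ≡⟨ monomial-⋆ j f n ⟩
  shift j f n                         ∎
  where open ≡-Reasoning

⋆-identityˡ : ∀ f → monomial 0 ⋆ f ≗ f
⋆-identityˡ = monomial-⋆ 0

monomial-nonNeg : ∀ j n → 0ℚ ≤ monomial j n
monomial-nonNeg zero    zero    = ℕ→ℚ-nonNeg 1
monomial-nonNeg zero    (suc n) = ≤-refl
monomial-nonNeg (suc j) zero    = ≤-refl
monomial-nonNeg (suc j) (suc n) = monomial-nonNeg j n

monomial-below : ∀ j n → n ℕ.< j → monomial j n ≡ 0ℚ
monomial-below (suc j) zero    _         = refl
monomial-below (suc j) (suc n) (s≤s n<j) = monomial-below j n n<j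

θ-monomial : ∀ j → θ (monomial j) ≗ ℕ→ℚ j · monomial j
θ-monomial zero    zero    = refl
θ-monomial zero    (suc n) = trans (*-zeroʳ (ℕ→ℚ (suc n))) (sym (*-zeroʳ 0ℚ))
θ-monomial (suc j) zero    = trans (*-zeroʳ 0ℚ) (sym (*-zeroʳ (ℕ→ℚ (suc j))))
θ-monomial (suc j) (suc n) = begin
  ℕ→ℚ (suc n) * monomial j n               ≡⟨ cong (_* monomial j n) (ℕ→ℚ-homo-+ 1 n) ⟩
  (1ℚ + ℕ→ℚ n) * monomial j n              ≡⟨ *-distribʳ-+ (monomial j n) 1ℚ (ℕ→ℚ n) ⟩
  1ℚ * monomial j n + ℕ→ℚ n * monomial j n ≡⟨ cong (1ℚ * monomial j n +_) (θ-monomial j n) ⟩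
  1ℚ * monomial j n + ℕ→ℚ j * monomial j n ≡⟨ sym (*-distribʳ-+ (monomial j n) 1ℚ (ℕ→ℚ j)) ⟩
  (1ℚ + ℕ→ℚ j) * monomial j n              ≡⟨ cong (_* monomial j n) (sym (ℕ→ℚ-homo-+ 1 j)) ⟩
  ℕ→ℚ (suc j) * monomial j n               ∎
  where open ≡-Reasoning

shift-cong : ∀ c {f g} n → f ≡[≤ n ] g → shift c f n ≡ shift c g n
shift-cong zero    n       eq = eq n ℕP.≤-refl
shift-cong (suc c) zero    eq = refl
shift-cong (suc c) (suc n) eq = shift-cong c n (λ m m≤n → eq m (ℕP.m≤n⇒m≤1+n m≤n))

shift-⊕ : ∀ c f g → shift c (f ⊕ g) ≗ shift c f ⊕ shift c g
shift-⊕ zero    f g n       = refl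
shift-⊕ (suc c) f g zero    = sym (+-identityˡ 0ℚ)
shift-⊕ (suc c) f g (suc n) = shift-⊕ c f g n

shift-· : ∀ c k f → shift c (k · f) ≗ k · shift c f
shift-· zero    k f n       = refl
shift-· (suc c) k f zero    = sym (*-zeroʳ k)
shift-· (suc c) k f (suc n) = shift-· c k f n

shift-sum : ∀ c K (B : ℕ → Series) n → shift c (λ m → sumℚ K (λ k → B k m)) n ≡ sumℚ K (λ k → shift c (B k) n)
shift-sum zero    K B n       = refl
shift-sum (suc c) K B zero    = sym (sumℚ-zero K (λ _ _ → refl))
shift-sum (suc c) K B (suc n) = shift-sum c K B n

shift-below : ∀ c f n → n ℕ.< c → shift c f n ≡ 0ℚ
shift-below (suc c) f zero    _         = refl
shift-below (suc c) f (suc n) (s≤s n<c) = shift-below c f n n<c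

shift-above : ∀ c f n → c ℕ.≤ n → shift c f n ≡ f (n ℕ.∸ c)
shift-above zero    f n       _         = refl
shift-above (suc c) f (suc n) (s≤s c≤n) = shift-above c f n c≤n

shift-monomial : ∀ c j → shift c (monomial j) ≗ monomial (c ℕ.+ j)
shift-monomial zero    j n       = refl
shift-monomial (suc c) j zero    = refl
shift-monomial (suc c) j (suc n) = shift-monomial c j n

shift-⋆ˡ : ∀ c a b → shift c a ⋆ b ≗ shift c (a ⋆ b)
shift-⋆ˡ c a b n = begin
  (shift c a ⋆ b) n        ≡⟨ ⋆-congˡ b n (λ m _ → sym (monomial-⋆ c a m)) ⟩
  ((monomial c ⋆ a) ⋆ b) n ≡⟨ ⋆-assoc (monomial c) a b n ⟩
  (monomial c ⋆ (a ⋆ b)) n ≡⟨ monomial-⋆ c (a ⋆ b) n ⟩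
  shift c (a ⋆ b) n        ∎
  where open ≡-Reasoning

shift-⋆ʳ : ∀ c a b → a ⋆ shift c b ≗ shift c (a ⋆ b)
shift-⋆ʳ c a b n = trans (⋆-comm a (shift c b) n)
  (trans (shift-⋆ˡ c b a n) (shift-cong c n (λ m _ → ⋆-comm b a m)))

θ-shift : ∀ c f → θ (shift c f) ≗ ℕ→ℚ c · shift c f ⊕ shift c (θ f)
θ-shift zero    f n       = sym (trans (cong (_+ θ f n) (*-zeroˡ (f n))) (+-identityˡ _))
θ-shift (suc c) f zero    = trans (*-zeroʳ 0ℚ) (sym (trans (+-identityʳ _) (*-zeroʳ (ℕ→ℚ (suc c)))))
θ-shift (suc c) f (suc n) = begin
  ℕ→ℚ (suc n) * shift c f n
    ≡⟨ cong (_* shift c f n) (ℕ→ℚ-homo-+ 1 n) ⟩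
  (1ℚ + ℕ→ℚ n) * shift c f n
    ≡⟨ *-distribʳ-+ (shift c f n) 1ℚ (ℕ→ℚ n) ⟩
  1ℚ * shift c f n + θ (shift c f) n
    ≡⟨ cong (1ℚ * shift c f n +_) (θ-shift c f n) ⟩
  1ℚ * shift c f n + (ℕ→ℚ c * shift c f n + shift c (θ f) n)
    ≡⟨ solve 4 (λ x y z w → x :* y :+ (z :* y :+ w) := (x :+ z) :* y :+ w) refl 1ℚ (shift c f n) (ℕ→ℚ c)
         (shift c (θ f) n) ⟩
  (1ℚ + ℕ→ℚ c) * shift c f n + shift c (θ f) n
    ≡⟨ cong (λ x → x * shift c f n + shift c (θ f) n) (sym (ℕ→ℚ-homo-+ 1 c)) ⟩
  ℕ→ℚ (suc c) * shift c f n + shift c (θ f) n ∎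
  where open ≡-Reasoning

θ-⋆ : ∀ a b → θ (a ⋆ b) ≗ θ a ⋆ b ⊕ a ⋆ θ b
θ-⋆ a b n = begin
  ℕ→ℚ n * (a ⋆ b) n
    ≡⟨ *-distribˡ-sumℚ (suc n) (ℕ→ℚ n) _ ⟩
  sumℚ (suc n) (λ i → ℕ→ℚ n * (a i * b (n ℕ.∸ i)))
    ≡⟨ sumℚ-cong-< (suc n) (λ i i≤n → leibnizTerm i (ℕP.≤-pred i≤n)) ⟩
  sumℚ (suc n) (λ i → θ a i * b (n ℕ.∸ i) + a i * θ b (n ℕ.∸ i))
    ≡⟨ sumℚ-distrib-+ (suc n) _ _ ⟩
  (θ a ⋆ b) n + (a ⋆ θ b) n ∎
  where
  open ≡-Reasoning
  leibnizTerm : ∀ i → i ℕ.≤ n → ℕ→ℚ n * (a i * b (n ℕ.∸ i)) ≡ θ a i * b (n ℕ.∸ i) + a i * θ b (n ℕ.∸ i)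
  leibnizTerm i i≤n = begin
    ℕ→ℚ n * (a i * b (n ℕ.∸ i))
      ≡⟨ cong (λ k → ℕ→ℚ k * (a i * b (n ℕ.∸ i))) (sym (ℕP.m+[n∸m]≡n i≤n)) ⟩
    ℕ→ℚ (i ℕ.+ (n ℕ.∸ i)) * (a i * b (n ℕ.∸ i))
      ≡⟨ cong (_* (a i * b (n ℕ.∸ i))) (ℕ→ℚ-homo-+ i (n ℕ.∸ i)) ⟩
    (ℕ→ℚ i + ℕ→ℚ (n ℕ.∸ i)) * (a i * b (n ℕ.∸ i))
      ≡⟨ solve 4 (λ x y z w → (x :+ y) :* (z :* w) := x :* z :* w :+ z :* (y :* w)) refl (ℕ→ℚ i)
           (ℕ→ℚ (n ℕ.∸ i)) (a i) (b (n ℕ.∸ i)) ⟩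
    θ a i * b (n ℕ.∸ i) + a i * θ b (n ℕ.∸ i) ∎

shift-equation-unique : ∀ N c (R X Y : Series) →
  X ≡[≤ N ] R ⊕ shift (suc c) X → Y ≡[≤ N ] R ⊕ shift (suc c) Y → X ≡[≤ N ] Y
shift-equation-unique N c R X Y eqX eqY = <-rec (λ n → n ℕ.≤ N → X n ≡ Y n) step
  where
  step : ∀ n → (∀ {m} → m ℕ.< n → m ℕ.≤ N → X m ≡ Y m) → n ℕ.≤ N → X n ≡ Y n
  step zero    _  0≤N = trans (eqX 0 0≤N) (sym (eqY 0 0≤N))
  step (suc n) ih n<N = begin
    X (suc n)
      ≡⟨ eqX (suc n) n<N ⟩
    R (suc n) + shift c X n
      ≡⟨ cong (R (suc n) +_) (shift-cong c n (λ m m≤n → ih (s≤s m≤n) (ℕP.≤-trans m≤n (ℕP.<⇒≤ n<N)))) ⟩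
    R (suc n) + shift c Y n
      ≡⟨ sym (eqY (suc n) n<N) ⟩
    Y (suc n) ∎
    where open ≡-Reasoning

θ-equation-unique : ∀ N (s a b : Series) → s 0 ≡ 0ℚ → a 0 ≡ b 0 →
  θ a ≡[≤ N ] s ⋆ a → θ b ≡[≤ N ] s ⋆ b → a ≡[≤ N ] b
θ-equation-unique N s a b s₀≡0 a₀≡b₀ θa θb = <-rec (λ n → n ℕ.≤ N → a n ≡ b n) step
  where
  tail : Series → Series
  tail f n = sumℚ (suc n) (λ i → s (suc i) * f (n ℕ.∸ i))
  s⋆-suc : ∀ f n → (s ⋆ f) (suc n) ≡ tail f n
  s⋆-suc f n = begin
    (s ⋆ f) (suc n)            ≡⟨ sumℚ-suc (suc n) _ ⟩
    s 0 * f (suc n) + tail f n ≡⟨ cong (λ x → x * f (suc n) + tail f n) s₀≡0 ⟩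
    0ℚ * f (suc n) + tail f n  ≡⟨ cong (_+ tail f n) (*-zeroˡ (f (suc n))) ⟩
    0ℚ + tail f n              ≡⟨ +-identityˡ _ ⟩
    tail f n                   ∎
    where open ≡-Reasoning
  step : ∀ n → (∀ {m} → m ℕ.< n → m ℕ.≤ N → a m ≡ b m) → n ℕ.≤ N → a n ≡ b n
  step zero    _  _   = a₀≡b₀
  step (suc n) ih n<N = ℕ→ℚ-*-cancelˡ (suc n) (begin
    θ a (suc n)
      ≡⟨ trans (θa (suc n) n<N) (s⋆-suc a n) ⟩
    tail a n
      ≡⟨ sumℚ-cong (suc n)
           (λ i → cong (s (suc i) *_) (ih (s≤s (ℕP.m∸n≤m n i)) (ℕP.≤-trans (ℕP.m∸n≤m n i) (ℕP.<⇒≤ n<N)))) ⟩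
    tail b n
      ≡⟨ sym (trans (θb (suc n) n<N) (s⋆-suc b n)) ⟩
    θ b (suc n) ∎)
    where open ≡-Reasoning

partsWithMultiplicity : ℕ → ℕ → ℕ → ℕ
partsWithMultiplicity n m j =
  if j ℕ.* suc m ℕ.≤ᵇ n then partsAtMost (n ℕ.∸ j ℕ.* suc m) m else 0

partsAtMost-suc : ∀ n m → partsAtMost n (suc m) ≡ sumℕ (suc n) (partsWithMultiplicity n m)
partsAtMost-suc zero    m = refl
partsAtMost-suc (suc n) m = refl

partsWithMultiplicity-≤ : ∀ n m j → j ℕ.* suc m ℕ.≤ n →
  partsWithMultiplicity n m j ≡ partsAtMost (n ℕ.∸ j ℕ.* suc m) m
partsWithMultiplicity-≤ n m j le with j ℕ.* suc m ℕ.≤ᵇ n | ℕP.≤⇒≤ᵇ le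
... | true | _ = refl

partsWithMultiplicity-≰ : ∀ n m j → ¬ (j ℕ.* suc m ℕ.≤ n) → partsWithMultiplicity n m j ≡ 0
partsWithMultiplicity-≰ n m j nle with j ℕ.* suc m ℕ.≤ᵇ n in eq
... | true  = ⊥-elim (nle (ℕP.≤ᵇ⇒≤ (j ℕ.* suc m) n (subst T (sym eq) tt)))
... | false = refl

partsWithMultiplicity-suc : ∀ n m j → suc m ℕ.≤ n →
  partsWithMultiplicity n m (suc j) ≡ partsWithMultiplicity (n ℕ.∸ suc m) m j
partsWithMultiplicity-suc n m j m<n with j ℕ.* suc m ℕ.≤? n ℕ.∸ suc m
... | yes le = begin
  partsWithMultiplicity n m (suc j)
    ≡⟨ partsWithMultiplicity-≤ n m (suc j) le′ ⟩
  partsAtMost (n ℕ.∸ (suc m ℕ.+ j ℕ.* suc m)) m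
    ≡⟨ cong (λ k → partsAtMost k m) (sym (ℕP.∸-+-assoc n (suc m) (j ℕ.* suc m))) ⟩
  partsAtMost (n ℕ.∸ suc m ℕ.∸ j ℕ.* suc m) m
    ≡⟨ sym (partsWithMultiplicity-≤ (n ℕ.∸ suc m) m j le) ⟩
  partsWithMultiplicity (n ℕ.∸ suc m) m j ∎
  where
  open ≡-Reasoning
  le′ : suc m ℕ.+ j ℕ.* suc m ℕ.≤ n
  le′ = subst (suc m ℕ.+ j ℕ.* suc m ℕ.≤_) (ℕP.m+[n∸m]≡n m<n) (ℕP.+-monoʳ-≤ (suc m) le)
... | no nle = trans (partsWithMultiplicity-≰ n m (suc j) nle′) (sym (partsWithMultiplicity-≰ (n ℕ.∸ suc m) m j nle))
  where
  nle′ : ¬ (suc m ℕ.+ j ℕ.* suc m ℕ.≤ n)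
  nle′ le = nle (subst (ℕ._≤ n ℕ.∸ suc m) (ℕP.m+n∸m≡n (suc m) (j ℕ.* suc m)) (ℕP.∸-monoˡ-≤ (suc m) le))

partitionSeries : ℕ → Series
partitionSeries m n = ℕ→ℚ (partsAtMost n m)

partitionSeries-zero : partitionSeries 0 ≗ monomial 0
partitionSeries-zero zero    = refl
partitionSeries-zero (suc n) = refl

partitionSeries-at0 : ∀ m → partitionSeries m 0 ≡ 1ℚ
partitionSeries-at0 zero    = refl
partitionSeries-at0 (suc m) = partitionSeries-at0 m

partitionSeries-suc : ∀ m → partitionSeries (suc m) ≗ partitionSeries m ⊕ shift (suc m) (partitionSeries (suc m))
partitionSeries-suc m n = begin
  partitionSeries (suc m) n
    ≡⟨ cong ℕ→ℚ (partsAtMost-suc n m) ⟩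
  ℕ→ℚ (sumℕ (suc n) (partsWithMultiplicity n m))
    ≡⟨ ℕ→ℚ-homo-sumℕ (suc n) _ ⟩
  sumℚ (suc n) (λ j → ℕ→ℚ (partsWithMultiplicity n m j))
    ≡⟨ sumℚ-suc n _ ⟩
  partitionSeries m n + largestPartUsed
    ≡⟨ cong (partitionSeries m n +_) largestPartUsed≡shift ⟩
  partitionSeries m n + shift (suc m) (partitionSeries (suc m)) n ∎
  where
  open ≡-Reasoning
  largestPartUsed : ℚ
  largestPartUsed = sumℚ n (λ j → ℕ→ℚ (partsWithMultiplicity n m (suc j)))
  largestPartUsed≡shift : largestPartUsed ≡ shift (suc m) (partitionSeries (suc m)) n
  largestPartUsed≡shift with suc m ℕ.≤? n
  ... | no m≮n = trans (sumℚ-zero n (λ j _ → cong ℕ→ℚ (partsWithMultiplicity-≰ n m (suc j)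
                          (λ le → m≮n (ℕP.≤-trans (ℕP.m≤m+n (suc m) (j ℕ.* suc m)) le)))))
                   (sym (shift-below (suc m) _ n (ℕP.≰⇒> m≮n)))
  ... | yes m<n = begin
    largestPartUsed
      ≡⟨ sumℚ-cong n (λ j → cong ℕ→ℚ (partsWithMultiplicity-suc n m j m<n)) ⟩
    sumℚ n (λ j → ℕ→ℚ (partsWithMultiplicity n′ m j))
      ≡⟨ sumℚ-zero-tail (suc n′) n n′<n (λ j n′<j →
           cong ℕ→ℚ (partsWithMultiplicity-≰ n′ m j (tooMany j n′<j))) ⟩
    sumℚ (suc n′) (λ j → ℕ→ℚ (partsWithMultiplicity n′ m j))
      ≡⟨ sym (trans (cong ℕ→ℚ (partsAtMost-suc n′ m)) (ℕ→ℚ-homo-sumℕ (suc n′) _)) ⟩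
    partitionSeries (suc m) n′
      ≡⟨ sym (shift-above (suc m) _ n m<n) ⟩
    shift (suc m) (partitionSeries (suc m)) n ∎
    where
    n′ : ℕ
    n′ = n ℕ.∸ suc m
    n′<n : suc n′ ℕ.≤ n
    n′<n = ℕP.∸-monoʳ-< {n} {suc m} {0} (s≤s z≤n) m<n
    tooMany : ∀ j → n′ ℕ.< j → ¬ (j ℕ.* suc m ℕ.≤ n′)
    tooMany j n′<j le = ℕP.<-irrefl refl (ℕP.<-≤-trans n′<j (ℕP.≤-trans (ℕP.m≤m*n j (suc m)) le))

partitionSeries-stable : ∀ m n → n ℕ.≤ m → partitionSeries (suc m) n ≡ partitionSeries m n
partitionSeries-stable m n n≤m = trans (partitionSeries-suc m n)
  (trans (cong (partitionSeries m n +_) (shift-below (suc m) _ n (s≤s n≤m))) (+-identityʳ _))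

partitionSeries≡p : ∀ m n → n ℕ.≤ m → partitionSeries m n ≡ ℕ→ℚ (p n)
partitionSeries≡p zero    zero _    = refl
partitionSeries≡p (suc m) n    n≤m with ℕP.m≤n⇒m<n∨m≡n n≤m
... | inj₁ (s≤s n≤m) = trans (partitionSeries-stable m n n≤m) (partitionSeries≡p m n n≤m)
... | inj₂ refl      = refl

⋆^-cong : ∀ {a a′} → a ≗ a′ → ∀ j → a ⋆^ j ≗ a′ ⋆^ j
⋆^-cong eq zero    m = refl
⋆^-cong {a} {a′} eq (suc j) m =
  trans (⋆-congˡ (a ⋆^ j) m (λ k _ → eq k)) (⋆-congʳ a′ m (λ k _ → ⋆^-cong eq j k))

⋆^-constant : ∀ x j → (x · monomial 0) ⋆^ j ≗ x ^ℚ j · monomial 0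
⋆^-constant x zero    m = sym (*-identityˡ (monomial 0 m))
⋆^-constant x (suc j) m = begin
  ((x · monomial 0) ⋆ (x · monomial 0) ⋆^ j) m
    ≡⟨ ⋆-·ˡ x (monomial 0) ((x · monomial 0) ⋆^ j) m ⟩
  x * (monomial 0 ⋆ (x · monomial 0) ⋆^ j) m
    ≡⟨ cong (x *_) (trans (⋆-identityˡ ((x · monomial 0) ⋆^ j) m) (⋆^-constant x j m)) ⟩
  x * (x ^ℚ j * monomial 0 m)
    ≡⟨ sym (*-assoc x (x ^ℚ j) (monomial 0 m)) ⟩
  x ^ℚ suc j * monomial 0 m ∎
  where open ≡-Reasoning

⋆^-nonNeg : ∀ a → (∀ m → 0ℚ ≤ a m) → ∀ k m → 0ℚ ≤ (a ⋆^ k) m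
⋆^-nonNeg a a≥0 zero    m = monomial-nonNeg 0 m
⋆^-nonNeg a a≥0 (suc k) m = ⋆-nonNeg a (a ⋆^ k) a≥0 (⋆^-nonNeg a a≥0 k) m

⋆^-below : ∀ a → a 0 ≡ 0ℚ → ∀ k n → n ℕ.< k → (a ⋆^ k) n ≡ 0ℚ
⋆^-below a a₀≡0 (suc k) n (s≤s n<k) = sumℚ-zero (suc n) vanish
  where
  vanish : ∀ i → i ℕ.< suc n → a i * (a ⋆^ k) (n ℕ.∸ i) ≡ 0ℚ
  vanish zero    _         = trans (cong (_* (a ⋆^ k) n) a₀≡0) (*-zeroˡ ((a ⋆^ k) n))
  vanish (suc i) (s≤s i<n) = trans (cong (a (suc i) *_) (⋆^-below a a₀≡0 k (n ℕ.∸ suc i)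
    (ℕP.<-≤-trans (ℕP.∸-monoʳ-< {n} {suc i} {0} (s≤s z≤n) i<n) n<k))) (*-zeroʳ (a (suc i)))

θ-⋆^-suc : ∀ a k → θ (a ⋆^ suc k) ≗ ℕ→ℚ (suc k) · (θ a ⋆ a ⋆^ k)
θ-⋆^-suc a zero n = begin
  θ (a ⋆ monomial 0) n
    ≡⟨ θ-⋆ a (monomial 0) n ⟩
  (θ a ⋆ monomial 0) n + (a ⋆ θ (monomial 0)) n
    ≡⟨ cong ((θ a ⋆ monomial 0) n +_)
         (⋆-zeroʳ a (θ (monomial 0)) n (λ m _ → trans (θ-monomial 0 m) (*-zeroˡ (monomial 0 m)))) ⟩
  (θ a ⋆ monomial 0) n + 0ℚ
    ≡⟨ trans (+-identityʳ _) (sym (*-identityˡ ((θ a ⋆ monomial 0) n))) ⟩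
  1ℚ * (θ a ⋆ monomial 0) n ∎
  where open ≡-Reasoning
θ-⋆^-suc a (suc k) n = begin
  θ (a ⋆ a ⋆^ suc k) n
    ≡⟨ θ-⋆ a (a ⋆^ suc k) n ⟩
  (θ a ⋆ a ⋆^ suc k) n + (a ⋆ θ (a ⋆^ suc k)) n
    ≡⟨ cong (x +_) (⋆-congʳ a n (λ m _ → θ-⋆^-suc a k m)) ⟩
  x + (a ⋆ ℕ→ℚ (suc k) · (θ a ⋆ a ⋆^ k)) n
    ≡⟨ cong (x +_) (⋆-·ʳ a (ℕ→ℚ (suc k)) (θ a ⋆ a ⋆^ k) n) ⟩
  x + ℕ→ℚ (suc k) * (a ⋆ (θ a ⋆ a ⋆^ k)) n
    ≡⟨ cong (λ y → x + ℕ→ℚ (suc k) * y) (⋆-leftComm a (θ a) (a ⋆^ k) n) ⟩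
  x + ℕ→ℚ (suc k) * x
    ≡⟨ solve 2 (λ x y → x :+ y :* x := (con 1ℚ :+ y) :* x) refl x (ℕ→ℚ (suc k)) ⟩
  (1ℚ + ℕ→ℚ (suc k)) * x
    ≡⟨ cong (_* x) (sym (ℕ→ℚ-homo-+ 1 (suc k))) ⟩
  ℕ→ℚ (suc (suc k)) * x ∎
  where
  open ≡-Reasoning
  x : ℚ
  x = (θ a ⋆ a ⋆^ suc k) n

dividedPower : Series → ℕ → Series
dividedPower a j = invFact j · a ⋆^ j

dividedPower-suc : ∀ a j → ℕ→ℚ (suc j) · dividedPower a (suc j) ≗ a ⋆ dividedPower a j
dividedPower-suc a j m = begin
  ℕ→ℚ (suc j) * (invFact (suc j) * (a ⋆ a ⋆^ j) m) ≡⟨ sym (*-assoc (ℕ→ℚ (suc j)) (invFact (suc j)) _) ⟩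
  ℕ→ℚ (suc j) * invFact (suc j) * (a ⋆ a ⋆^ j) m   ≡⟨ cong (_* (a ⋆ a ⋆^ j) m) (invFact-suc j) ⟩
  invFact j * (a ⋆ a ⋆^ j) m                       ≡⟨ sym (⋆-·ʳ a (invFact j) (a ⋆^ j) m) ⟩
  (a ⋆ dividedPower a j) m                         ∎
  where open ≡-Reasoning

module _ (a b : Series) where

  binomialSum : ℕ → Series
  binomialSum K n = sumℚ (suc K) (λ k → (dividedPower a (K ℕ.∸ k) ⋆ dividedPower b k) n)

  binomialSum-θˡ : ∀ K n →
    sumℚ (suc (suc K)) (λ k → ℕ→ℚ (suc K ℕ.∸ k) * (dividedPower a (suc K ℕ.∸ k) ⋆ dividedPower b k) n)
      ≡ (a ⋆ binomialSum K) n
  binomialSum-θˡ K n = begin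
    sumℚ (suc K) (λ k → w k * t k) + w (suc K) * t (suc K)
      ≡⟨ cong (sumℚ (suc K) (λ k → w k * t k) +_)
           (trans (cong (λ j → ℕ→ℚ j * t (suc K)) (ℕP.n∸n≡0 (suc K))) (*-zeroˡ (t (suc K)))) ⟩
    sumℚ (suc K) (λ k → w k * t k) + 0ℚ
      ≡⟨ +-identityʳ _ ⟩
    sumℚ (suc K) (λ k → w k * t k)
      ≡⟨ sumℚ-cong-< (suc K) (λ k k≤K → lowerDegree k (ℕP.≤-pred k≤K)) ⟩
    sumℚ (suc K) (λ k → (a ⋆ (dividedPower a (K ℕ.∸ k) ⋆ dividedPower b k)) n)
      ≡⟨ sym (⋆-sumʳ a (suc K) (λ k → dividedPower a (K ℕ.∸ k) ⋆ dividedPower b k) n) ⟩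
    (a ⋆ binomialSum K) n ∎
    where
    open ≡-Reasoning
    w t : ℕ → ℚ
    w k = ℕ→ℚ (suc K ℕ.∸ k)
    t k = (dividedPower a (suc K ℕ.∸ k) ⋆ dividedPower b k) n
    lowerDegree : ∀ k → k ℕ.≤ K → w k * t k ≡ (a ⋆ (dividedPower a (K ℕ.∸ k) ⋆ dividedPower b k)) n
    lowerDegree k k≤K rewrite ℕP.+-∸-assoc 1 k≤K = begin
      ℕ→ℚ (suc j) * (dividedPower a (suc j) ⋆ dividedPower b k) n
        ≡⟨ sym (⋆-·ˡ (ℕ→ℚ (suc j)) (dividedPower a (suc j)) (dividedPower b k) n) ⟩
      (ℕ→ℚ (suc j) · dividedPower a (suc j) ⋆ dividedPower b k) n
        ≡⟨ ⋆-congˡ (dividedPower b k) n (λ m _ → dividedPower-suc a j m) ⟩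
      ((a ⋆ dividedPower a j) ⋆ dividedPower b k) n
        ≡⟨ ⋆-assoc a (dividedPower a j) (dividedPower b k) n ⟩
      (a ⋆ (dividedPower a j ⋆ dividedPower b k)) n ∎
      where
      j : ℕ
      j = K ℕ.∸ k

  binomialSum-θʳ : ∀ K n →
    sumℚ (suc (suc K)) (λ k → ℕ→ℚ k * (dividedPower a (suc K ℕ.∸ k) ⋆ dividedPower b k) n)
      ≡ (b ⋆ binomialSum K) n
  binomialSum-θʳ K n = begin
    sumℚ (suc (suc K)) (λ k → ℕ→ℚ k * t k)
      ≡⟨ sumℚ-suc (suc K) _ ⟩
    0ℚ * t 0 + sumℚ (suc K) (λ k → ℕ→ℚ (suc k) * t (suc k))
      ≡⟨ trans (cong (_+ sumℚ (suc K) (λ k → ℕ→ℚ (suc k) * t (suc k))) (*-zeroˡ (t 0))) (+-identityˡ _) ⟩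
    sumℚ (suc K) (λ k → ℕ→ℚ (suc k) * t (suc k))
      ≡⟨ sumℚ-cong (suc K) raiseDegree ⟩
    sumℚ (suc K) (λ k → (b ⋆ (dividedPower a (K ℕ.∸ k) ⋆ dividedPower b k)) n)
      ≡⟨ sym (⋆-sumʳ b (suc K) (λ k → dividedPower a (K ℕ.∸ k) ⋆ dividedPower b k) n) ⟩
    (b ⋆ binomialSum K) n ∎
    where
    open ≡-Reasoning
    t : ℕ → ℚ
    t k = (dividedPower a (suc K ℕ.∸ k) ⋆ dividedPower b k) n
    raiseDegree : ∀ k → ℕ→ℚ (suc k) * t (suc k) ≡ (b ⋆ (dividedPower a (K ℕ.∸ k) ⋆ dividedPower b k)) n
    raiseDegree k = begin
      ℕ→ℚ (suc k) * (dividedPower a (K ℕ.∸ k) ⋆ dividedPower b (suc k)) n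
        ≡⟨ sym (⋆-·ʳ (dividedPower a (K ℕ.∸ k)) (ℕ→ℚ (suc k)) (dividedPower b (suc k)) n) ⟩
      (dividedPower a (K ℕ.∸ k) ⋆ ℕ→ℚ (suc k) · dividedPower b (suc k)) n
        ≡⟨ ⋆-congʳ (dividedPower a (K ℕ.∸ k)) n (λ m _ → dividedPower-suc b k m) ⟩
      (dividedPower a (K ℕ.∸ k) ⋆ (b ⋆ dividedPower b k)) n
        ≡⟨ ⋆-leftComm (dividedPower a (K ℕ.∸ k)) b (dividedPower b k) n ⟩
      (b ⋆ (dividedPower a (K ℕ.∸ k) ⋆ dividedPower b k)) n ∎

  binomialSum-suc : ∀ K → ℕ→ℚ (suc K) · binomialSum (suc K) ≗ (a ⊕ b) ⋆ binomialSum K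
  binomialSum-suc K n = begin
    ℕ→ℚ (suc K) * binomialSum (suc K) n
      ≡⟨ *-distribˡ-sumℚ (suc (suc K)) (ℕ→ℚ (suc K)) _ ⟩
    sumℚ (suc (suc K)) (λ k → ℕ→ℚ (suc K) * t k)
      ≡⟨ sumℚ-cong-< (suc (suc K)) (λ k k≤1+K → trans (cong (_* t k) (splitDegree k (ℕP.≤-pred k≤1+K)))
                                                       (*-distribʳ-+ (t k) (ℕ→ℚ (suc K ℕ.∸ k)) (ℕ→ℚ k))) ⟩
    sumℚ (suc (suc K)) (λ k → ℕ→ℚ (suc K ℕ.∸ k) * t k + ℕ→ℚ k * t k)
      ≡⟨ sumℚ-distrib-+ (suc (suc K)) (λ k → ℕ→ℚ (suc K ℕ.∸ k) * t k) (λ k → ℕ→ℚ k * t k) ⟩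
    sumℚ (suc (suc K)) (λ k → ℕ→ℚ (suc K ℕ.∸ k) * t k) + sumℚ (suc (suc K)) (λ k → ℕ→ℚ k * t k)
      ≡⟨ cong₂ _+_ (binomialSum-θˡ K n) (binomialSum-θʳ K n) ⟩
    (a ⋆ binomialSum K) n + (b ⋆ binomialSum K) n
      ≡⟨ sym (⋆-distribʳ-⊕ a b (binomialSum K) n) ⟩
    ((a ⊕ b) ⋆ binomialSum K) n ∎
    where
    open ≡-Reasoning
    t : ℕ → ℚ
    t k = (dividedPower a (suc K ℕ.∸ k) ⋆ dividedPower b k) n
    splitDegree : ∀ k → k ℕ.≤ suc K → ℕ→ℚ (suc K) ≡ ℕ→ℚ (suc K ℕ.∸ k) + ℕ→ℚ k
    splitDegree k k≤ = trans (cong ℕ→ℚ (sym (ℕP.m∸n+n≡m k≤))) (ℕ→ℚ-homo-+ (suc K ℕ.∸ k) k)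

  dividedPower-⊕ : ∀ K → dividedPower (a ⊕ b) K ≗ binomialSum K
  dividedPower-⊕ zero    n = begin
    invFact 0 * monomial 0 n
      ≡⟨ *-identityˡ (monomial 0 n) ⟩
    monomial 0 n
      ≡⟨ sym (⋆-identityˡ (monomial 0) n) ⟩
    (monomial 0 ⋆ monomial 0) n
      ≡⟨ sym (⋆-congˡ (monomial 0) n (λ m _ → *-identityˡ (monomial 0 m))) ⟩
    (dividedPower a 0 ⋆ monomial 0) n
      ≡⟨ sym (⋆-congʳ (dividedPower a 0) n (λ m _ → *-identityˡ (monomial 0 m))) ⟩
    (dividedPower a 0 ⋆ dividedPower b 0) n
      ≡⟨ sym (+-identityˡ _) ⟩
    binomialSum 0 n ∎
    where open ≡-Reasoning
  dividedPower-⊕ (suc K) n = ℕ→ℚ-*-cancelˡ (suc K) (begin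
    ℕ→ℚ (suc K) * dividedPower (a ⊕ b) (suc K) n ≡⟨ dividedPower-suc (a ⊕ b) K n ⟩
    ((a ⊕ b) ⋆ dividedPower (a ⊕ b) K) n         ≡⟨ ⋆-congʳ (a ⊕ b) n (λ m _ → dividedPower-⊕ K m) ⟩
    ((a ⊕ b) ⋆ binomialSum K) n                  ≡⟨ sym (binomialSum-suc K n) ⟩
    ℕ→ℚ (suc K) * binomialSum (suc K) n            ∎)
    where open ≡-Reasoning

expTerm : ℚ → ℕ → ℚ
expTerm x j = x ^ℚ j * invFact j

expTerm-nonNeg : ∀ {x} → 0ℚ ≤ x → ∀ j → 0ℚ ≤ expTerm x j
expTerm-nonNeg x≥0 j = *-nonNeg (^ℚ-nonNeg j x≥0) (invFact-nonNeg j)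

expTerm-suc : ∀ x k → expTerm x (suc k) ≡ x * recip (suc k) * expTerm x k
expTerm-suc x k = begin
  x * x ^ℚ k * invFact (suc k)
    ≡⟨ cong (x * x ^ℚ k *_) (recip-homo-* (suc k) (k !) {{_}} {{k ℕP.!≢0}}) ⟩
  x * x ^ℚ k * (recip (suc k) * invFact k)
    ≡⟨ solve 4 (λ z p r f → z :* p :* (r :* f) := z :* r :* (p :* f)) refl x (x ^ℚ k) (recip (suc k)) (invFact k) ⟩
  x * recip (suc k) * expTerm x k ∎
  where open ≡-Reasoning

expPartial : ℕ → ℚ → ℚ
expPartial K x = sumℚ K (expTerm x)

expPartial-nonNeg : ∀ K {x} → 0ℚ ≤ x → 0ℚ ≤ expPartial K x
expPartial-nonNeg K x≥0 = sumℚ-nonNeg K (λ j _ → expTerm-nonNeg x≥0 j)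

expPartial-1 : ∀ K → expPartial K 1ℚ ≡ ePartial K
expPartial-1 K = sumℚ-cong K (λ j → trans (cong (_* invFact j) (1^ℚ j)) (*-identityˡ (invFact j)))

dividedPower-constant : ∀ x j → dividedPower (x · monomial 0) j 0 ≡ expTerm x j
dividedPower-constant x j = trans (cong (invFact j *_) (trans (⋆^-constant x j 0) (*-identityʳ (x ^ℚ j))))
  (*-comm (invFact j) (x ^ℚ j))

binomial-theorem : ∀ x y K →
  expTerm (x + y) K ≡ sumℚ (suc K) (λ k → expTerm x (K ℕ.∸ k) * expTerm y k)
binomial-theorem x y K = begin
  expTerm (x + y) K
    ≡⟨ sym (dividedPower-constant (x + y) K) ⟩
  dividedPower ((x + y) · monomial 0) K 0
    ≡⟨ cong (invFact K *_) (⋆^-cong (λ m → *-distribʳ-+ (monomial 0 m) x y) K 0) ⟩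
  dividedPower (x · monomial 0 ⊕ y · monomial 0) K 0
    ≡⟨ dividedPower-⊕ (x · monomial 0) (y · monomial 0) K 0 ⟩
  binomialSum (x · monomial 0) (y · monomial 0) K 0
    ≡⟨ sumℚ-cong (suc K)
         (λ k → trans (+-identityˡ _) (cong₂ _*_ (dividedPower-constant x (K ℕ.∸ k)) (dividedPower-constant y k))) ⟩
  sumℚ (suc K) (λ k → expTerm x (K ℕ.∸ k) * expTerm y k) ∎
  where open ≡-Reasoning

expPartial-+-≤ : ∀ K {x y} → 0ℚ ≤ x → 0ℚ ≤ y → expPartial K (x + y) ≤ expPartial K x * expPartial K y
expPartial-+-≤ K {x} {y} x≥0 y≥0 = begin
  expPartial K (x + y)
    ≡⟨ sumℚ-cong K (binomial-theorem x y) ⟩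
  sumℚ K (λ j → sumℚ (suc j) (λ k → expTerm x (j ℕ.∸ k) * expTerm y k))
    ≤⟨ sumℚ-convolution-≤ K (expTerm x) (expTerm y) (expTerm-nonNeg x≥0) (expTerm-nonNeg y≥0) ⟩
  expPartial K x * expPartial K y ∎
  where open ≤-Reasoning

-- C is the value 1/(1 - x) of the full geometric series.
geometricSum-≤ : ∀ {x C} → 0ℚ ≤ x → 0ℚ ≤ C → 1ℚ + x * C ≡ C → ∀ K → sumℚ K (x ^ℚ_) ≤ C
geometricSum-≤ {x} {C} x≥0 C≥0 fixed K = begin
  sumℚ K (x ^ℚ_)              ≤⟨ p≤p+q (*-nonNeg (^ℚ-nonNeg K x≥0) C≥0) ⟩
  sumℚ K (x ^ℚ_) + x ^ℚ K * C ≡⟨ partialSum+remainder K ⟩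
  C                           ∎
  where
  open ≤-Reasoning
  partialSum+remainder : ∀ K → sumℚ K (x ^ℚ_) + x ^ℚ K * C ≡ C
  partialSum+remainder zero    = trans (+-identityˡ _) (*-identityˡ C)
  partialSum+remainder (suc K) = begin-equality
    sumℚ K (x ^ℚ_) + x ^ℚ K + x * x ^ℚ K * C
      ≡⟨ solve 4 (λ g p y c → g :+ p :+ y :* p :* c := g :+ p :* (con 1ℚ :+ y :* c)) refl (sumℚ K (x ^ℚ_))
           (x ^ℚ K) x C ⟩
    sumℚ K (x ^ℚ_) + x ^ℚ K * (1ℚ + x * C)
      ≡⟨ cong (λ y → sumℚ K (x ^ℚ_) + x ^ℚ K * y) fixed ⟩
    sumℚ K (x ^ℚ_) + x ^ℚ K * C
      ≡⟨ partialSum+remainder K ⟩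
    C ∎

expPartial-recip-≤ : ∀ n K → expPartial K (recip (suc (suc n))) ≤ ℕ→ℚ (suc (suc n)) * recip (suc n)
expPartial-recip-≤ n K = begin
  expPartial K x
    ≤⟨ sumℚ-mono-≤ K
         (λ j _ → ≤-trans (*-monoˡ-≤-0≤ (^ℚ-nonNeg j x≥0) (invFact≤1 j)) (≤-reflexive (*-identityʳ _))) ⟩
  sumℚ K (x ^ℚ_)
    ≤⟨ geometricSum-≤ x≥0 (*-nonNeg (ℕ→ℚ-nonNeg (suc (suc n))) (recip-nonNeg (suc n))) fixed K ⟩
  C ∎
  where
  open ≤-Reasoning
  x C : ℚ
  x = recip (suc (suc n))
  C = ℕ→ℚ (suc (suc n)) * recip (suc n)
  x≥0 : 0ℚ ≤ x
  x≥0 = recip-nonNeg (suc (suc n))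
  fixed : 1ℚ + x * C ≡ C
  fixed = begin-equality
    1ℚ + x * (ℕ→ℚ (suc (suc n)) * recip (suc n))
      ≡⟨ cong (1ℚ +_) (trans (sym (*-assoc x (ℕ→ℚ (suc (suc n))) (recip (suc n))))
                             (trans (cong (_* recip (suc n)) (recip-inverseˡ (suc (suc n)))) (*-identityˡ (recip (suc n))))) ⟩
    1ℚ + recip (suc n)
      ≡⟨ cong (_+ recip (suc n)) (sym (recip-inverseʳ (suc n))) ⟩
    ℕ→ℚ (suc n) * recip (suc n) + recip (suc n)
      ≡⟨ solve 2 (λ a i → a :* i :+ i := (con 1ℚ :+ a) :* i) refl (ℕ→ℚ (suc n)) (recip (suc n)) ⟩
    (1ℚ + ℕ→ℚ (suc n)) * recip (suc n)
      ≡⟨ cong (_* recip (suc n)) (sym (ℕ→ℚ-homo-+ 1 (suc n))) ⟩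
    C ∎

harmonic : ℕ → ℚ
harmonic n = sumℚ n (λ d → recip (suc d))

harmonic-nonNeg : ∀ n → 0ℚ ≤ harmonic n
harmonic-nonNeg n = sumℚ-nonNeg n (λ d _ → recip-nonNeg (suc d))

-- e^(H_N) ≤ e·N, since e^(1/d) ≤ 1/(1 - 1/d) = d/(d-1) and these factors telescope for d ≥ 2.
expPartial-harmonic-≤ : ∀ K n → expPartial K (harmonic (suc n)) ≤ ePartial K * ℕ→ℚ (suc n)
expPartial-harmonic-≤ K zero = begin
  expPartial K (0ℚ + recip 1) ≡⟨ cong (expPartial K) (+-identityˡ (recip 1)) ⟩
  expPartial K 1ℚ             ≡⟨ expPartial-1 K ⟩
  ePartial K                  ≡⟨ sym (*-identityʳ (ePartial K)) ⟩
  ePartial K * ℕ→ℚ 1          ∎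
  where open ≤-Reasoning
expPartial-harmonic-≤ K (suc n) = begin
  expPartial K (harmonic (suc n) + recip (suc (suc n)))
    ≤⟨ expPartial-+-≤ K (harmonic-nonNeg (suc n)) (recip-nonNeg (suc (suc n))) ⟩
  expPartial K (harmonic (suc n)) * expPartial K (recip (suc (suc n)))
    ≤⟨ *-mono-≤-0≤ (expPartial-nonNeg K (harmonic-nonNeg (suc n)))
         (*-nonNeg (ℕ→ℚ-nonNeg (suc (suc n))) (recip-nonNeg (suc n))) (expPartial-harmonic-≤ K n)
         (expPartial-recip-≤ n K) ⟩
  ePartial K * ℕ→ℚ (suc n) * (ℕ→ℚ (suc (suc n)) * recip (suc n))
    ≡⟨ solve 4 (λ e a b i → e :* a :* (b :* i) := e :* b :* (i :* a)) refl (ePartial K) (ℕ→ℚ (suc n))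
         (ℕ→ℚ (suc (suc n))) (recip (suc n)) ⟩
  ePartial K * ℕ→ℚ (suc (suc n)) * (recip (suc n) * ℕ→ℚ (suc n))
    ≡⟨ cong (ePartial K * ℕ→ℚ (suc (suc n)) *_) (recip-inverseˡ (suc n)) ⟩
  ePartial K * ℕ→ℚ (suc (suc n)) * 1ℚ
    ≡⟨ *-identityʳ _ ⟩
  ePartial K * ℕ→ℚ (suc (suc n)) ∎
  where open ≤-Reasoning

cumulative : Series → Series
cumulative f M = sumℚ (suc M) f

cumulative-⋆ : ∀ a f → cumulative (a ⋆ f) ≗ a ⋆ cumulative f
cumulative-⋆ a f M = begin
  sumℚ (suc M) (a ⋆ f) ≡⟨ sumℚ-cong (suc M) (λ i → sym (*-identityʳ _)) ⟩
  ((a ⋆ f) ⋆ ones) M   ≡⟨ ⋆-assoc a f ones M ⟩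
  (a ⋆ (f ⋆ ones)) M   ≡⟨ ⋆-congʳ a M (λ m _ → sumℚ-cong (suc m) (λ i → *-identityʳ (f i))) ⟩
  (a ⋆ cumulative f) M ∎
  where
  open ≡-Reasoning
  ones : Series
  ones _ = 1ℚ

θ-dividedPower-suc : ∀ a k → θ (dividedPower a (suc k)) ≗ θ a ⋆ dividedPower a k
θ-dividedPower-suc a k n = begin
  ℕ→ℚ n * (invFact (suc k) * (a ⋆^ suc k) n)
    ≡⟨ solve 3 (λ x y z → x :* (y :* z) := y :* (x :* z)) refl (ℕ→ℚ n) (invFact (suc k)) _ ⟩
  invFact (suc k) * θ (a ⋆^ suc k) n
    ≡⟨ cong (invFact (suc k) *_) (θ-⋆^-suc a k n) ⟩
  invFact (suc k) * (ℕ→ℚ (suc k) * (θ a ⋆ a ⋆^ k) n)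
    ≡⟨ solve 3 (λ x y z → x :* (y :* z) := y :* x :* z) refl (invFact (suc k)) (ℕ→ℚ (suc k)) _ ⟩
  ℕ→ℚ (suc k) * invFact (suc k) * (θ a ⋆ a ⋆^ k) n
    ≡⟨ cong (_* (θ a ⋆ a ⋆^ k) n) (invFact-suc k) ⟩
  invFact k * (θ a ⋆ a ⋆^ k) n
    ≡⟨ sym (⋆-·ʳ (θ a) (invFact k) (a ⋆^ k) n) ⟩
  (θ a ⋆ dividedPower a k) n ∎
  where open ≡-Reasoning

expSeries : ℕ → Series → Series
expSeries K a n = sumℚ K (λ k → dividedPower a k n)

expSeries-at0 : ∀ K a → a 0 ≡ 0ℚ → expSeries (suc K) a 0 ≡ 1ℚ
expSeries-at0 K a a₀≡0 = begin
  expSeries (suc K) a 0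
    ≡⟨ sumℚ-suc K _ ⟩
  invFact 0 * 1ℚ + sumℚ K (λ k → dividedPower a (suc k) 0)
    ≡⟨ cong (invFact 0 * 1ℚ +_) (sumℚ-zero K (λ k _ →
         trans (cong (invFact (suc k) *_) (⋆^-below a a₀≡0 (suc k) 0 (s≤s z≤n))) (*-zeroʳ (invFact (suc k))))) ⟩
  1ℚ * 1ℚ + 0ℚ
    ≡⟨⟩
  1ℚ ∎
  where open ≡-Reasoning

-- Truncating exp a after a^K is invisible modulo z^(K+1), as a^(K+1) starts at z^(K+1).
θ-expSeries : ∀ K a → a 0 ≡ 0ℚ → θ (expSeries (suc K) a) ≡[≤ K ] θ a ⋆ expSeries (suc K) a
θ-expSeries K a a₀≡0 n n≤K = begin
  ℕ→ℚ n * sumℚ (suc K) (λ k → dividedPower a k n)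
    ≡⟨ *-distribˡ-sumℚ (suc K) (ℕ→ℚ n) _ ⟩
  sumℚ (suc K) (λ k → θ (dividedPower a k) n)
    ≡⟨ sumℚ-suc K _ ⟩
  θ (dividedPower a 0) n + sumℚ K (λ k → θ (dividedPower a (suc k)) n)
    ≡⟨ cong₂ _+_ θconstant (sumℚ-cong K (λ k → θ-dividedPower-suc a k n)) ⟩
  0ℚ + sumℚ K (λ k → (θ a ⋆ dividedPower a k) n)
    ≡⟨ +-identityˡ _ ⟩
  sumℚ K (λ k → (θ a ⋆ dividedPower a k) n)
    ≡⟨ sym (trans (cong (sumℚ K (λ k → (θ a ⋆ dividedPower a k) n) +_) topTerm) (+-identityʳ _)) ⟩
  sumℚ (suc K) (λ k → (θ a ⋆ dividedPower a k) n)
    ≡⟨ sym (⋆-sumʳ (θ a) (suc K) (dividedPower a) n) ⟩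
  (θ a ⋆ expSeries (suc K) a) n ∎
  where
  open ≡-Reasoning
  θconstant : θ (dividedPower a 0) n ≡ 0ℚ
  θconstant = trans (cong (ℕ→ℚ n *_) (*-identityˡ (monomial 0 n)))
    (trans (θ-monomial 0 n) (*-zeroˡ (monomial 0 n)))
  topTerm : (θ a ⋆ dividedPower a K) n ≡ 0ℚ
  topTerm = begin
    (θ a ⋆ dividedPower a K) n
      ≡⟨ sym (θ-dividedPower-suc a K n) ⟩
    ℕ→ℚ n * (invFact (suc K) * (a ⋆^ suc K) n)
      ≡⟨ cong (λ x → ℕ→ℚ n * (invFact (suc K) * x)) (⋆^-below a a₀≡0 (suc K) n (s≤s n≤K)) ⟩
    ℕ→ℚ n * (invFact (suc K) * 0ℚ)
      ≡⟨ trans (cong (ℕ→ℚ n *_) (*-zeroʳ (invFact (suc K)))) (*-zeroʳ (ℕ→ℚ n)) ⟩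
    0ℚ ∎

ℕ→ℚ-shiftℕ : ∀ c g n → ℕ→ℚ (shiftℕ c g n) ≡ shift c (λ m → ℕ→ℚ (g m)) n
ℕ→ℚ-shiftℕ zero    g n       = refl
ℕ→ℚ-shiftℕ (suc c) g zero    = refl
ℕ→ℚ-shiftℕ (suc c) g (suc n) = ℕ→ℚ-shiftℕ c g n

ℕ→ℚ-≤-*recip : ∀ a X B .{{_ : NonZero a}} → a ℕ.* X ℕ.≤ B → ℕ→ℚ X ≤ ℕ→ℚ B * recip a
ℕ→ℚ-≤-*recip a X B aX≤B = begin
  ℕ→ℚ X                   ≡⟨ sym (recip-*-ℕ→ℚ a X) ⟩
  recip a * ℕ→ℚ (a ℕ.* X) ≤⟨ *-monoˡ-≤-0≤ (recip-nonNeg a) (ℕ→ℚ-mono-≤ aX≤B) ⟩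
  recip a * ℕ→ℚ B         ≡⟨ *-comm (recip a) (ℕ→ℚ B) ⟩
  ℕ→ℚ B * recip a         ∎
  where open ≤-Reasoning

ℕ→ℚ-*recip-≤ : ∀ a X B .{{_ : NonZero a}} → B ℕ.≤ a ℕ.* X → ℕ→ℚ B * recip a ≤ ℕ→ℚ X
ℕ→ℚ-*recip-≤ a X B B≤aX = begin
  ℕ→ℚ B * recip a         ≡⟨ *-comm (ℕ→ℚ B) (recip a) ⟩
  recip a * ℕ→ℚ B         ≤⟨ *-monoˡ-≤-0≤ (recip-nonNeg a) (ℕ→ℚ-mono-≤ B≤aX) ⟩
  recip a * ℕ→ℚ (a ℕ.* X) ≡⟨ recip-*-ℕ→ℚ a X ⟩
  ℕ→ℚ X                   ∎
  where open ≤-Reasoning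

powers : ℕ → Series
powers k m = ℕ→ℚ (m ℕ.^ k)

ℕ→ℚ-shiftedPowers : ∀ k E (c : ℕ → ℕ) M →
  ℕ→ℚ (sumℕ E (λ e → shiftℕ (c e) (ℕ._^ k) M)) ≡ sumℚ E (λ e → shift (c e) (powers k) M)
ℕ→ℚ-shiftedPowers k E c M =
  trans (ℕ→ℚ-homo-sumℕ E _) (sumℚ-cong E (λ e → ℕ→ℚ-shiftℕ (c e) (ℕ._^ k) M))

shiftedPowers-≤ : ∀ k h E M .{{_ : NonZero h}} →
  sumℚ E (λ e → shift (suc e ℕ.* h) (powers k) M) ≤ ℕ→ℚ (M ℕ.^ suc k) * (recip (suc k) * recip h)
shiftedPowers-≤ k h E M = begin
  sumℚ E (λ e → shift (suc e ℕ.* h) (powers k) M)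
    ≡⟨ sym (ℕ→ℚ-shiftedPowers k E (λ e → suc e ℕ.* h) M) ⟩
  ℕ→ℚ X
    ≤⟨ ℕ→ℚ-≤-*recip (suc k ℕ.* h) X (M ℕ.^ suc k) {{ℕP.m*n≢0 (suc k) h}}
         (ℕP.≤-trans (ℕP.m≤m+n _ _) (riemannSum-lowerBound k h E M)) ⟩
  ℕ→ℚ (M ℕ.^ suc k) * recip (suc k ℕ.* h) {{ℕP.m*n≢0 (suc k) h}}
    ≡⟨ cong (ℕ→ℚ (M ℕ.^ suc k) *_) (recip-homo-* (suc k) h) ⟩
  ℕ→ℚ (M ℕ.^ suc k) * (recip (suc k) * recip h) ∎
  where
  open ≤-Reasoning
  X : ℕ
  X = sumℕ E (λ e → shiftℕ (suc e ℕ.* h) (ℕ._^ k) M)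

shiftedPowers-≥ : ∀ k h E M .{{_ : NonZero h}} → M ℕ.≤ E ℕ.* h →
  ℕ→ℚ (M ℕ.^ suc k) * (recip (suc k) * recip h) ≤ sumℚ E (λ e → shift (e ℕ.* h) (powers k) M)
shiftedPowers-≥ k h E M M≤Eh = begin
  ℕ→ℚ (M ℕ.^ suc k) * (recip (suc k) * recip h)
    ≡⟨ cong (ℕ→ℚ (M ℕ.^ suc k) *_) (sym (recip-homo-* (suc k) h)) ⟩
  ℕ→ℚ (M ℕ.^ suc k) * recip (suc k ℕ.* h) {{ℕP.m*n≢0 (suc k) h}}
    ≤⟨ ℕ→ℚ-*recip-≤ (suc k ℕ.* h) X (M ℕ.^ suc k) {{ℕP.m*n≢0 (suc k) h}} riemann ⟩
  ℕ→ℚ X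
    ≡⟨ ℕ→ℚ-shiftedPowers k E (λ e → e ℕ.* h) M ⟩
  sumℚ E (λ e → shift (e ℕ.* h) (powers k) M) ∎
  where
  open ≤-Reasoning
  X : ℕ
  X = sumℕ E (λ e → shiftℕ (e ℕ.* h) (ℕ._^ k) M)
  riemann : M ℕ.^ suc k ℕ.≤ suc k ℕ.* h ℕ.* X
  riemann = subst (M ℕ.^ suc k ℕ.≤_)
    (trans (cong (λ r → suc k ℕ.* h ℕ.* X ℕ.+ r ℕ.^ suc k) (ℕP.m≤n⇒m∸n≡0 M≤Eh)) (ℕP.+-identityʳ _))
    (riemannSum-upperBound k h E M)

besselI0Partial-term : ∀ x y k → invFact k * (expTerm x k * y ^ℚ k) ≡
  (x * y) ^ℚ k * recip (k ! ℕ.* k !) {{ℕP.m*n≢0 (k !) (k !) {{k ℕP.!≢0}} {{k ℕP.!≢0}}}}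
besselI0Partial-term x y k = begin
  invFact k * ((x ^ℚ k * invFact k) * y ^ℚ k)
    ≡⟨ solve 4 (λ f a b g → f :* (a :* g :* b) := a :* b :* (f :* g)) refl (invFact k) (x ^ℚ k) (y ^ℚ k)
         (invFact k) ⟩
  x ^ℚ k * y ^ℚ k * (invFact k * invFact k)
    ≡⟨ cong₂ _*_ (sym (^ℚ-distrib-* x y k)) (sym (recip-homo-* (k !) (k !) {{k ℕP.!≢0}} {{k ℕP.!≢0}})) ⟩
  (x * y) ^ℚ k * recip (k ! ℕ.* k !) {{ℕP.m*n≢0 (k !) (k !) {{k ℕP.!≢0}} {{k ℕP.!≢0}}}} ∎
  where open ≡-Reasoning

cumulative-monomial0 : ∀ M → cumulative (monomial 0) M ≡ 1ℚ
cumulative-monomial0 M = trans (sumℚ-suc M (monomial 0))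
  (trans (cong (1ℚ +_) (sumℚ-zero M (λ _ _ → refl))) (+-identityʳ 1ℚ))

dividedPower-constant-⋆ : ∀ x j g → dividedPower (x · monomial 0) j ⋆ g ≗ expTerm x j · g
dividedPower-constant-⋆ x j g n = begin
  (dividedPower (x · monomial 0) j ⋆ g) n
    ≡⟨ ⋆-congˡ g n
         (λ m _ → trans (cong (invFact j *_) (⋆^-constant x j m)) (sym (*-assoc (invFact j) (x ^ℚ j) (monomial 0 m)))) ⟩
  ((invFact j * x ^ℚ j) · monomial 0 ⋆ g) n
    ≡⟨ ⋆-·ˡ (invFact j * x ^ℚ j) (monomial 0) g n ⟩
  invFact j * x ^ℚ j * (monomial 0 ⋆ g) n
    ≡⟨ cong₂ _*_ (*-comm (invFact j) (x ^ℚ j)) (⋆-identityˡ g n) ⟩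
  x ^ℚ j * invFact j * g n ∎
  where open ≡-Reasoning

-- Partitions as an exponential

module _ (N : ℕ) where

  -- log ∏_{m ≤ N} (1 - z^m)⁻¹ = Σ_{m ≤ N} Σ_{d ≥ 1} z^(dm)/d; modulo z^(N+1) only d ≤ N matters.
  logPartitions : Series
  logPartitions n = sumℚ N (λ d → recip (suc d) * sumℚ N (λ m → monomial (suc d ℕ.* suc m) n))

  -- θ log (1 - z^(m+1))⁻¹ modulo z^(N+1); θlogPartitions k is θ log ∏_{j ≤ k} (1 - z^j)⁻¹.
  θlogFactor : ℕ → Series
  θlogFactor m n = ℕ→ℚ (suc m) * sumℚ N (λ d → monomial (suc d ℕ.* suc m) n)

  θlogPartitions : ℕ → Series
  θlogPartitions k n = sumℚ k (λ m → θlogFactor m n)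

  logPartitions-at0 : logPartitions 0 ≡ 0ℚ
  logPartitions-at0 = sumℚ-zero N (λ d _ →
    trans (cong (recip (suc d) *_) (sumℚ-zero N (λ _ _ → refl))) (*-zeroʳ (recip (suc d))))

  θ-logPartitions : θ logPartitions ≗ θlogPartitions N
  θ-logPartitions n = begin
    ℕ→ℚ n * logPartitions n
      ≡⟨ *-distribˡ-sumℚ N (ℕ→ℚ n) _ ⟩
    sumℚ N (λ d → ℕ→ℚ n * (recip (suc d) * sumℚ N (z^ d)))
      ≡⟨ sumℚ-cong N θ-inner ⟩
    sumℚ N (λ d → sumℚ N (λ m → ℕ→ℚ (suc m) * z^ d m))
      ≡⟨ sumℚ-comm N N _ ⟩
    sumℚ N (λ m → sumℚ N (λ d → ℕ→ℚ (suc m) * z^ d m))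
      ≡⟨ sumℚ-cong N (λ m → sym (*-distribˡ-sumℚ N (ℕ→ℚ (suc m)) _)) ⟩
    θlogPartitions N n ∎
    where
    open ≡-Reasoning
    z^ : ℕ → ℕ → ℚ
    z^ d m = monomial (suc d ℕ.* suc m) n
    θ-inner : ∀ d → ℕ→ℚ n * (recip (suc d) * sumℚ N (z^ d)) ≡ sumℚ N (λ m → ℕ→ℚ (suc m) * z^ d m)
    θ-inner d = begin
      ℕ→ℚ n * (recip (suc d) * sumℚ N (z^ d))
        ≡⟨ solve 3 (λ x y z → x :* (y :* z) := y :* (x :* z)) refl (ℕ→ℚ n) (recip (suc d)) (sumℚ N (z^ d)) ⟩
      recip (suc d) * (ℕ→ℚ n * sumℚ N (z^ d))
        ≡⟨ cong (recip (suc d) *_) (*-distribˡ-sumℚ N (ℕ→ℚ n) (z^ d)) ⟩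
      recip (suc d) * sumℚ N (λ m → θ (monomial (suc d ℕ.* suc m)) n)
        ≡⟨ cong (recip (suc d) *_) (sumℚ-cong N (λ m → θ-monomial (suc d ℕ.* suc m) n)) ⟩
      recip (suc d) * sumℚ N (λ m → ℕ→ℚ (suc d ℕ.* suc m) * z^ d m)
        ≡⟨ *-distribˡ-sumℚ N (recip (suc d)) _ ⟩
      sumℚ N (λ m → recip (suc d) * (ℕ→ℚ (suc d ℕ.* suc m) * z^ d m))
        ≡⟨ sumℚ-cong N (λ m → trans (sym (*-assoc (recip (suc d)) (ℕ→ℚ (suc d ℕ.* suc m)) (z^ d m)))
                                     (cong (_* z^ d m) (recip-*-ℕ→ℚ (suc d) (suc m)))) ⟩
      sumℚ N (λ m → ℕ→ℚ (suc m) * z^ d m) ∎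

  θlogFactor-equation : ∀ m → θlogFactor m ≡[≤ N ] ℕ→ℚ (suc m) · monomial (suc m) ⊕ shift (suc m) (θlogFactor m)
  θlogFactor-equation m n n≤N = sym (begin
    M * monomial (suc m) n + shift (suc m) (θlogFactor m) n
      ≡⟨ cong (M * monomial (suc m) n +_) (shift-· (suc m) M _ n) ⟩
    M * monomial (suc m) n + M * shift (suc m) multiples n
      ≡⟨ sym (*-distribˡ-+ M _ _) ⟩
    M * (monomial (suc m) n + shift (suc m) multiples n)
      ≡⟨ cong (M *_) (cong₂ _+_ (cong (λ j → monomial j n) (sym (ℕP.+-identityʳ (suc m)))) shiftedMultiples) ⟩
    M * (monomial (1 ℕ.* suc m) n + sumℚ N (λ d → monomial (suc (suc d) ℕ.* suc m) n))
      ≡⟨ cong (M *_) (sym (sumℚ-suc N (λ d → monomial (suc d ℕ.* suc m) n))) ⟩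
    M * sumℚ (suc N) (λ d → monomial (suc d ℕ.* suc m) n)
      ≡⟨ cong (M *_) (trans (cong (multiples n +_) topVanishes) (+-identityʳ (multiples n))) ⟩
    θlogFactor m n ∎)
    where
    open ≡-Reasoning
    M : ℚ
    M = ℕ→ℚ (suc m)
    multiples : Series
    multiples n = sumℚ N (λ d → monomial (suc d ℕ.* suc m) n)
    shiftedMultiples : shift (suc m) multiples n ≡ sumℚ N (λ d → monomial (suc (suc d) ℕ.* suc m) n)
    shiftedMultiples = trans (shift-sum (suc m) N _ n)
      (sumℚ-cong N (λ d → shift-monomial (suc m) (suc d ℕ.* suc m) n))
    topVanishes : monomial (suc N ℕ.* suc m) n ≡ 0ℚ
    topVanishes = monomial-below (suc N ℕ.* suc m) n (ℕP.<-≤-trans (s≤s n≤N) (ℕP.m≤m*n (suc N) (suc m)))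

  θlogFactor-⋆-partitionSeries : ∀ m →
    θlogFactor m ⋆ partitionSeries m ≡[≤ N ] ℕ→ℚ (suc m) · shift (suc m) (partitionSeries (suc m))
  θlogFactor-⋆-partitionSeries m =
    shift-equation-unique N m (M · shift (suc m) (partitionSeries m)) _ _ lhs-equation rhs-equation
    where
    M : ℚ
    M = ℕ→ℚ (suc m)
    lhs-equation : θlogFactor m ⋆ partitionSeries m ≡[≤ N ]
      M · shift (suc m) (partitionSeries m) ⊕ shift (suc m) (θlogFactor m ⋆ partitionSeries m)
    lhs-equation n n≤N = begin
      (θlogFactor m ⋆ partitionSeries m) n
        ≡⟨ ⋆-congˡ (partitionSeries m) n (λ k k≤n → θlogFactor-equation m k (ℕP.≤-trans k≤n n≤N)) ⟩
      ((M · monomial (suc m) ⊕ shift (suc m) (θlogFactor m)) ⋆ partitionSeries m) n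
        ≡⟨ ⋆-distribʳ-⊕ (M · monomial (suc m)) (shift (suc m) (θlogFactor m)) (partitionSeries m) n ⟩
      (M · monomial (suc m) ⋆ partitionSeries m) n + (shift (suc m) (θlogFactor m) ⋆ partitionSeries m) n
        ≡⟨ cong₂ _+_
             (trans (⋆-·ˡ M (monomial (suc m)) (partitionSeries m) n) (cong (M *_) (monomial-⋆ (suc m) (partitionSeries m) n)))
             (shift-⋆ˡ (suc m) (θlogFactor m) (partitionSeries m) n) ⟩
      M * shift (suc m) (partitionSeries m) n + shift (suc m) (θlogFactor m ⋆ partitionSeries m) n ∎
      where open ≡-Reasoning
    rhs-equation : M · shift (suc m) (partitionSeries (suc m)) ≡[≤ N ]
      M · shift (suc m) (partitionSeries m) ⊕ shift (suc m) (M · shift (suc m) (partitionSeries (suc m)))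
    rhs-equation n _ = begin
      M * shift (suc m) (partitionSeries (suc m)) n
        ≡⟨ cong (M *_) (shift-cong (suc m) n (λ k _ → partitionSeries-suc m k)) ⟩
      M * shift (suc m) (partitionSeries m ⊕ shift (suc m) (partitionSeries (suc m))) n
        ≡⟨ cong (M *_) (shift-⊕ (suc m) _ _ n) ⟩
      M * (shift (suc m) (partitionSeries m) n + shift (suc m) (shift (suc m) (partitionSeries (suc m))) n)
        ≡⟨ *-distribˡ-+ M _ _ ⟩
      M * shift (suc m) (partitionSeries m) n + M * shift (suc m) (shift (suc m) (partitionSeries (suc m))) n
        ≡⟨ cong (M * shift (suc m) (partitionSeries m) n +_) (sym (shift-· (suc m) M _ n)) ⟩
      M * shift (suc m) (partitionSeries m) n + shift (suc m) (M · shift (suc m) (partitionSeries (suc m))) n ∎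
      where open ≡-Reasoning

  θ-partitionSeries : ∀ m → θ (partitionSeries m) ≡[≤ N ] θlogPartitions m ⋆ partitionSeries m
  θ-partitionSeries zero n _ = begin
    ℕ→ℚ n * partitionSeries 0 n
      ≡⟨ cong (ℕ→ℚ n *_) (partitionSeries-zero n) ⟩
    θ (monomial 0) n
      ≡⟨ trans (θ-monomial 0 n) (*-zeroˡ (monomial 0 n)) ⟩
    0ℚ
      ≡⟨ sym (sumℚ-zero (suc n) (λ i _ → *-zeroˡ (partitionSeries 0 (n ℕ.∸ i)))) ⟩
    (θlogPartitions 0 ⋆ partitionSeries 0) n ∎
    where open ≡-Reasoning
  θ-partitionSeries (suc m) = shift-equation-unique N m R _ _ lhs-equation rhs-equation
    where
    M : ℚ
    M = ℕ→ℚ (suc m)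
    P : Series
    P = partitionSeries (suc m)
    R : Series
    R = θlogPartitions m ⋆ partitionSeries m ⊕ M · shift (suc m) P
    lhs-equation : θ P ≡[≤ N ] R ⊕ shift (suc m) (θ P)
    lhs-equation n n≤N = begin
      ℕ→ℚ n * P n
        ≡⟨ cong (ℕ→ℚ n *_) (partitionSeries-suc m n) ⟩
      ℕ→ℚ n * (partitionSeries m n + shift (suc m) P n)
        ≡⟨ *-distribˡ-+ (ℕ→ℚ n) _ _ ⟩
      θ (partitionSeries m) n + θ (shift (suc m) P) n
        ≡⟨ cong₂ _+_ (θ-partitionSeries m n n≤N) (θ-shift (suc m) P n) ⟩
      (θlogPartitions m ⋆ partitionSeries m) n + (M * shift (suc m) P n + shift (suc m) (θ P) n)
        ≡⟨ sym
             (+-assoc ((θlogPartitions m ⋆ partitionSeries m) n) (M * shift (suc m) P n) (shift (suc m) (θ P) n)) ⟩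
      R n + shift (suc m) (θ P) n ∎
      where open ≡-Reasoning
    rhs-equation : θlogPartitions (suc m) ⋆ P ≡[≤ N ] R ⊕ shift (suc m) (θlogPartitions (suc m) ⋆ P)
    rhs-equation n n≤N = begin
      (θlogPartitions (suc m) ⋆ P) n
        ≡⟨ ⋆-congʳ (θlogPartitions (suc m)) n (λ k _ → partitionSeries-suc m k) ⟩
      (θlogPartitions (suc m) ⋆ (partitionSeries m ⊕ shift (suc m) P)) n
        ≡⟨ ⋆-distribˡ-⊕ (θlogPartitions (suc m)) (partitionSeries m) (shift (suc m) P) n ⟩
      (θlogPartitions (suc m) ⋆ partitionSeries m) n + (θlogPartitions (suc m) ⋆ shift (suc m) P) n
        ≡⟨ cong₂ _+_ (⋆-distribʳ-⊕ (θlogPartitions m) (θlogFactor m) (partitionSeries m) n)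
             (shift-⋆ʳ (suc m) (θlogPartitions (suc m)) P n) ⟩
      (θlogPartitions m ⋆ partitionSeries m) n + (θlogFactor m ⋆ partitionSeries m) n
        + shift (suc m) (θlogPartitions (suc m) ⋆ P) n
        ≡⟨ cong (λ x → (θlogPartitions m ⋆ partitionSeries m) n + x + shift (suc m) (θlogPartitions (suc m) ⋆ P) n)
             (θlogFactor-⋆-partitionSeries m n n≤N) ⟩
      R n + shift (suc m) (θlogPartitions (suc m) ⋆ P) n
        ∎
      where open ≡-Reasoning

  partitionSeries≡expSeries : partitionSeries N ≡[≤ N ] expSeries (suc N) logPartitions
  partitionSeries≡expSeries = θ-equation-unique N (θ logPartitions) _ _ (*-zeroˡ (logPartitions 0))
    (trans (partitionSeries-at0 N) (sym (expSeries-at0 N logPartitions logPartitions-at0)))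
    (λ n n≤N → trans (θ-partitionSeries N n n≤N) (⋆-congˡ (partitionSeries N) n (λ k _ → sym (θ-logPartitions k))))
    (θ-expSeries N logPartitions logPartitions-at0)

  partitionSum-expansion : ℕ→ℚ (partitionSum N) ≡ sumℚ (suc N) (λ k → invFact k * cumulative (logPartitions ⋆^ k) N)
  partitionSum-expansion = begin
    ℕ→ℚ (partitionSum N)
      ≡⟨ ℕ→ℚ-homo-sumℕ (suc N) p ⟩
    sumℚ (suc N) (λ n → ℕ→ℚ (p n))
      ≡⟨ sumℚ-cong-< (suc N) (λ n n<1+N → let n≤N = ℕP.≤-pred n<1+N in
           trans (sym (partitionSeries≡p N n n≤N)) (partitionSeries≡expSeries n n≤N)) ⟩
    sumℚ (suc N) (expSeries (suc N) logPartitions)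
      ≡⟨ sumℚ-comm (suc N) (suc N) _ ⟩
    sumℚ (suc N) (λ k → sumℚ (suc N) (dividedPower logPartitions k))
      ≡⟨ sumℚ-cong (suc N) (λ k → sym (*-distribˡ-sumℚ (suc N) (invFact k) _)) ⟩
    sumℚ (suc N) (λ k → invFact k * cumulative (logPartitions ⋆^ k) N) ∎
    where open ≡-Reasoning

  -- Upper bound

  zetaN2-as-squares : zetaN2 N ≡ sumℚ N (λ d → recip (suc d) * recip (suc d))
  zetaN2-as-squares = sumℚ-cong N (λ d → recip-homo-* (suc d) (suc d))

  zetaN2-nonNeg : 0ℚ ≤ zetaN2 N
  zetaN2-nonNeg = subst (0ℚ ≤_) (sym zetaN2-as-squares)
    (sumℚ-nonNeg N (λ d _ → *-nonNeg (recip-nonNeg (suc d)) (recip-nonNeg (suc d))))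

  logPartitions-nonNeg : ∀ m → 0ℚ ≤ logPartitions m
  logPartitions-nonNeg m = sumℚ-nonNeg N (λ d _ → *-nonNeg (recip-nonNeg (suc d))
    (sumℚ-nonNeg N (λ e _ → monomial-nonNeg (suc d ℕ.* suc e) m)))

  logPartitions-⋆ : ∀ f M →
    (logPartitions ⋆ f) M ≡ sumℚ N (λ d → recip (suc d) * sumℚ N (λ m → shift (suc m ℕ.* suc d) f M))
  logPartitions-⋆ f M = begin
    (logPartitions ⋆ f) M
      ≡⟨ ⋆-sumˡ N (λ d → recip (suc d) · multiples d) f M ⟩
    sumℚ N (λ d → (recip (suc d) · multiples d ⋆ f) M)
      ≡⟨ sumℚ-cong N (λ d → ⋆-·ˡ (recip (suc d)) (multiples d) f M) ⟩
    sumℚ N (λ d → recip (suc d) * (multiples d ⋆ f) M)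
      ≡⟨ sumℚ-cong N (λ d → cong (recip (suc d) *_) (multiples-⋆ d)) ⟩
    sumℚ N (λ d → recip (suc d) * sumℚ N (λ m → shift (suc m ℕ.* suc d) f M)) ∎
    where
    open ≡-Reasoning
    multiples : ℕ → Series
    multiples d n = sumℚ N (λ m → monomial (suc d ℕ.* suc m) n)
    multiples-⋆ : ∀ d → (multiples d ⋆ f) M ≡ sumℚ N (λ m → shift (suc m ℕ.* suc d) f M)
    multiples-⋆ d = trans (⋆-sumˡ N (λ m → monomial (suc d ℕ.* suc m)) f M) (sumℚ-cong N (λ m →
      trans (monomial-⋆ (suc d ℕ.* suc m) f M) (cong (λ j → shift j f M) (ℕP.*-comm (suc d) (suc m)))))

  logPartitions-⋆-powers-≤ : ∀ k M → (logPartitions ⋆ powers k) M ≤ zetaN2 N * recip (suc k) * ℕ→ℚ (M ℕ.^ suc k)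
  logPartitions-⋆-powers-≤ k M = begin
    (logPartitions ⋆ powers k) M
      ≡⟨ logPartitions-⋆ (powers k) M ⟩
    sumℚ N (λ d → recip (suc d) * sumℚ N (λ m → shift (suc m ℕ.* suc d) (powers k) M))
      ≤⟨ sumℚ-mono-≤ N
           (λ d _ → *-monoˡ-≤-0≤ (recip-nonNeg (suc d)) (shiftedPowers-≤ k (suc d) N M)) ⟩
    sumℚ N (λ d → recip (suc d) * (ℕ→ℚ (M ℕ.^ suc k) * (recip (suc k) * recip (suc d))))
      ≡⟨ sumℚ-cong N (λ d → solve 4 (λ r m i s → r :* (m :* (i :* s)) := i :* m :* (r :* s)) refl
                                 (recip (suc d)) (ℕ→ℚ (M ℕ.^ suc k)) (recip (suc k)) (recip (suc d))) ⟩
    sumℚ N (λ d → c * (recip (suc d) * recip (suc d)))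
      ≡⟨ sym (*-distribˡ-sumℚ N c _) ⟩
    c * sumℚ N (λ d → recip (suc d) * recip (suc d))
      ≡⟨ cong (c *_) (sym zetaN2-as-squares) ⟩
    c * zetaN2 N
      ≡⟨ solve 3 (λ i m z → i :* m :* z := z :* i :* m) refl (recip (suc k)) (ℕ→ℚ (M ℕ.^ suc k)) (zetaN2 N) ⟩
    zetaN2 N * recip (suc k) * ℕ→ℚ (M ℕ.^ suc k) ∎
    where
    open ≤-Reasoning
    c : ℚ
    c = recip (suc k) * ℕ→ℚ (M ℕ.^ suc k)

  besselI0Partial-as-coefficients : ∀ K →
    besselI0Partial (zetaN2 N * ℕ→ℚ N) K ≡ sumℚ K (λ k → invFact k * (expTerm (zetaN2 N) k * ℕ→ℚ (N ℕ.^ k)))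
  besselI0Partial-as-coefficients K = sumℚ-cong K (λ k → sym (trans
    (cong (λ y → invFact k * (expTerm (zetaN2 N) k * y)) (ℕ→ℚ-homo-^ N k))
    (besselI0Partial-term (zetaN2 N) (ℕ→ℚ N) k)))

  cumulative-logPartitions^-≤ : ∀ k M → cumulative (logPartitions ⋆^ k) M ≤ expTerm (zetaN2 N) k * ℕ→ℚ (M ℕ.^ k)
  cumulative-logPartitions^-≤ zero    M = ≤-reflexive (trans (cumulative-monomial0 M) (sym (*-identityʳ 1ℚ)))
  cumulative-logPartitions^-≤ (suc k) M = begin
    cumulative (logPartitions ⋆ logPartitions ⋆^ k) M
      ≡⟨ cumulative-⋆ logPartitions (logPartitions ⋆^ k) M ⟩
    (logPartitions ⋆ cumulative (logPartitions ⋆^ k)) M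
      ≤⟨ ⋆-monoʳ-≤ logPartitions M logPartitions-nonNeg (λ m _ → cumulative-logPartitions^-≤ k m) ⟩
    (logPartitions ⋆ expTerm (zetaN2 N) k · powers k) M
      ≡⟨ ⋆-·ʳ logPartitions (expTerm (zetaN2 N) k) (powers k) M ⟩
    expTerm (zetaN2 N) k * (logPartitions ⋆ powers k) M
      ≤⟨ *-monoˡ-≤-0≤ (expTerm-nonNeg zetaN2-nonNeg k)
           (logPartitions-⋆-powers-≤ k M) ⟩
    expTerm (zetaN2 N) k * (zetaN2 N * recip (suc k) * ℕ→ℚ (M ℕ.^ suc k))
      ≡⟨ solve 3 (λ b c m → b :* (c :* m) := c :* b :* m) refl (expTerm (zetaN2 N) k)
           (zetaN2 N * recip (suc k)) (ℕ→ℚ (M ℕ.^ suc k)) ⟩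
    zetaN2 N * recip (suc k) * expTerm (zetaN2 N) k * ℕ→ℚ (M ℕ.^ suc k)
      ≡⟨ cong (_* ℕ→ℚ (M ℕ.^ suc k)) (sym (expTerm-suc (zetaN2 N) k)) ⟩
    expTerm (zetaN2 N) (suc k) * ℕ→ℚ (M ℕ.^ suc k) ∎
    where open ≤-Reasoning

  partitionSum≤besselI0Partial : ℕ→ℚ (partitionSum N) ≤ besselI0Partial (zetaN2 N * ℕ→ℚ N) (suc N)
  partitionSum≤besselI0Partial = begin
    ℕ→ℚ (partitionSum N)
      ≡⟨ partitionSum-expansion ⟩
    sumℚ (suc N) (λ k → invFact k * cumulative (logPartitions ⋆^ k) N)
      ≤⟨ sumℚ-mono-≤ (suc N)
           (λ k _ → *-monoˡ-≤-0≤ (invFact-nonNeg k) (cumulative-logPartitions^-≤ k N)) ⟩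
    sumℚ (suc N) (λ k → invFact k * (expTerm (zetaN2 N) k * ℕ→ℚ (N ℕ.^ k)))
      ≡⟨ sym (besselI0Partial-as-coefficients (suc N)) ⟩
    besselI0Partial (zetaN2 N * ℕ→ℚ N) (suc N) ∎
    where open ≤-Reasoning

  -- Lower bound

  -- logPartitions with the terms z^(d·0)/d restored, which turns its coefficient sums into
  -- Riemann sums bounding ∫ x^k dx from above.
  logPartitions⁺ : Series
  logPartitions⁺ = harmonic N · monomial 0 ⊕ logPartitions

  logPartitions⁺-⋆ : ∀ f M →
    (logPartitions⁺ ⋆ f) M ≡ sumℚ N (λ d → recip (suc d) * sumℚ (suc N) (λ m → shift (m ℕ.* suc d) f M))
  logPartitions⁺-⋆ f M = begin
    (logPartitions⁺ ⋆ f) M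
      ≡⟨ ⋆-distribʳ-⊕ (harmonic N · monomial 0) logPartitions f M ⟩
    (harmonic N · monomial 0 ⋆ f) M + (logPartitions ⋆ f) M
      ≡⟨ cong₂ _+_ (trans (⋆-·ˡ (harmonic N) (monomial 0) f M) (cong (harmonic N *_) (⋆-identityˡ f M)))
           (logPartitions-⋆ f M) ⟩
    harmonic N * f M + sumℚ N (λ d → recip (suc d) * rest d)
      ≡⟨ cong (_+ sumℚ N (λ d → recip (suc d) * rest d)) (*-distribʳ-sumℚ N (f M) (λ d → recip (suc d))) ⟩
    sumℚ N (λ d → recip (suc d) * f M) + sumℚ N (λ d → recip (suc d) * rest d)
      ≡⟨ sym (sumℚ-distrib-+ N _ _) ⟩
    sumℚ N (λ d → recip (suc d) * f M + recip (suc d) * rest d)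
      ≡⟨ sumℚ-cong N (λ d → trans (sym (*-distribˡ-+ (recip (suc d)) (f M) (rest d)))
                                   (cong (recip (suc d) *_) (sym (sumℚ-suc N (λ m → shift (m ℕ.* suc d) f M))))) ⟩
    sumℚ N (λ d → recip (suc d) * sumℚ (suc N) (λ m → shift (m ℕ.* suc d) f M)) ∎
    where
    open ≡-Reasoning
    rest : ℕ → ℚ
    rest d = sumℚ N (λ m → shift (suc m ℕ.* suc d) f M)

  logPartitions⁺-⋆-powers-≥ : ∀ k M → M ℕ.≤ N →
    zetaN2 N * recip (suc k) * ℕ→ℚ (M ℕ.^ suc k) ≤ (logPartitions⁺ ⋆ powers k) M
  logPartitions⁺-⋆-powers-≥ k M M≤N = begin
    zetaN2 N * recip (suc k) * ℕ→ℚ (M ℕ.^ suc k)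
      ≡⟨ solve 3 (λ z i m → z :* i :* m := i :* m :* z) refl (zetaN2 N) (recip (suc k)) (ℕ→ℚ (M ℕ.^ suc k)) ⟩
    c * zetaN2 N
      ≡⟨ cong (c *_) (zetaN2-as-squares) ⟩
    c * sumℚ N (λ d → recip (suc d) * recip (suc d))
      ≡⟨ *-distribˡ-sumℚ N c _ ⟩
    sumℚ N (λ d → c * (recip (suc d) * recip (suc d)))
      ≡⟨ sumℚ-cong N (λ d → solve 4 (λ r m i s → i :* m :* (r :* s) := r :* (m :* (i :* s))) refl
                                 (recip (suc d)) (ℕ→ℚ (M ℕ.^ suc k)) (recip (suc k)) (recip (suc d))) ⟩
    sumℚ N (λ d → recip (suc d) * (ℕ→ℚ (M ℕ.^ suc k) * (recip (suc k) * recip (suc d))))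
      ≤⟨ sumℚ-mono-≤ N
           (λ d _ → *-monoˡ-≤-0≤ (recip-nonNeg (suc d)) (shiftedPowers-≥ k (suc d) (suc N) M (M≤[1+N][1+d] d))) ⟩
    sumℚ N (λ d → recip (suc d) * sumℚ (suc N) (λ m → shift (m ℕ.* suc d) (powers k) M))
      ≡⟨ sym (logPartitions⁺-⋆ (powers k) M) ⟩
    (logPartitions⁺ ⋆ powers k) M ∎
    where
    open ≤-Reasoning
    c : ℚ
    c = recip (suc k) * ℕ→ℚ (M ℕ.^ suc k)
    M≤[1+N][1+d] : ∀ d → M ℕ.≤ suc N ℕ.* suc d
    M≤[1+N][1+d] d = ℕP.≤-trans (ℕP.m≤n⇒m≤1+n M≤N) (ℕP.m≤m*n (suc N) (suc d))

  logPartitions⁺-nonNeg : ∀ m → 0ℚ ≤ logPartitions⁺ m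
  logPartitions⁺-nonNeg m = +-mono-≤ (*-nonNeg (harmonic-nonNeg N) (monomial-nonNeg 0 m)) (logPartitions-nonNeg m)

  cumulative-logPartitions⁺^-≥ : ∀ k M → M ℕ.≤ N →
    expTerm (zetaN2 N) k * ℕ→ℚ (M ℕ.^ k) ≤ cumulative (logPartitions⁺ ⋆^ k) M
  cumulative-logPartitions⁺^-≥ zero    M _   = ≤-reflexive (trans (*-identityʳ 1ℚ) (sym (cumulative-monomial0 M)))
  cumulative-logPartitions⁺^-≥ (suc k) M M≤N = begin
    expTerm (zetaN2 N) (suc k) * ℕ→ℚ (M ℕ.^ suc k)
      ≡⟨ cong (_* ℕ→ℚ (M ℕ.^ suc k)) (expTerm-suc (zetaN2 N) k) ⟩
    zetaN2 N * recip (suc k) * expTerm (zetaN2 N) k * ℕ→ℚ (M ℕ.^ suc k)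
      ≡⟨ solve 3 (λ b c m → c :* b :* m := b :* (c :* m)) refl (expTerm (zetaN2 N) k)
           (zetaN2 N * recip (suc k)) (ℕ→ℚ (M ℕ.^ suc k)) ⟩
    expTerm (zetaN2 N) k * (zetaN2 N * recip (suc k) * ℕ→ℚ (M ℕ.^ suc k))
      ≤⟨ *-monoˡ-≤-0≤ (expTerm-nonNeg zetaN2-nonNeg k)
           (logPartitions⁺-⋆-powers-≥ k M M≤N) ⟩
    expTerm (zetaN2 N) k * (logPartitions⁺ ⋆ powers k) M
      ≡⟨ sym (⋆-·ʳ logPartitions⁺ (expTerm (zetaN2 N) k) (powers k) M) ⟩
    (logPartitions⁺ ⋆ expTerm (zetaN2 N) k · powers k) M
      ≤⟨ ⋆-monoʳ-≤ logPartitions⁺ M logPartitions⁺-nonNeg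
           (λ m m≤M → cumulative-logPartitions⁺^-≥ k m (ℕP.≤-trans m≤M M≤N)) ⟩
    (logPartitions⁺ ⋆ cumulative (logPartitions⁺ ⋆^ k)) M
      ≡⟨ sym (cumulative-⋆ logPartitions⁺ (logPartitions⁺ ⋆^ k) M) ⟩
    cumulative (logPartitions⁺ ⋆^ suc k) M ∎
    where open ≤-Reasoning

  partitionSumTerm : ℕ → ℚ
  partitionSumTerm k = invFact k * cumulative (logPartitions ⋆^ k) N

  partitionSumTerm-nonNeg : ∀ k → 0ℚ ≤ partitionSumTerm k
  partitionSumTerm-nonNeg k = *-nonNeg (invFact-nonNeg k)
    (sumℚ-nonNeg (suc N) (λ n _ → ⋆^-nonNeg logPartitions logPartitions-nonNeg k n))

  partitionSumTerm-vanish : ∀ k → N ℕ.< k → partitionSumTerm k ≡ 0ℚ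
  partitionSumTerm-vanish k N<k = trans
    (cong (invFact k *_) (sumℚ-zero (suc N) (λ n n≤N →
      ⋆^-below logPartitions logPartitions-at0 k n (ℕP.<-≤-trans n≤N N<k))))
    (*-zeroʳ (invFact k))

  sumℚ-partitionSumTerm-≤ : ∀ K → sumℚ K partitionSumTerm ≤ ℕ→ℚ (partitionSum N)
  sumℚ-partitionSumTerm-≤ K = ≤-trans dropVanishing (≤-reflexive (sym partitionSum-expansion))
    where
    dropVanishing : sumℚ K partitionSumTerm ≤ sumℚ (suc N) partitionSumTerm
    dropVanishing with ℕP.≤-total K (suc N)
    ... | inj₁ K≤1+N = sumℚ-mono-length K (suc N) K≤1+N partitionSumTerm-nonNeg
    ... | inj₂ 1+N≤K = ≤-reflexive (sumℚ-zero-tail (suc N) K 1+N≤K partitionSumTerm-vanish)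

  cumulative-logPartitions⁺^-binomial : ∀ K →
    invFact K * cumulative (logPartitions⁺ ⋆^ K) N ≡
    sumℚ (suc K) (λ k → expTerm (harmonic N) (K ℕ.∸ k) * partitionSumTerm k)
  cumulative-logPartitions⁺^-binomial K = begin
    invFact K * cumulative (logPartitions⁺ ⋆^ K) N
      ≡⟨ *-distribˡ-sumℚ (suc N) (invFact K) _ ⟩
    sumℚ (suc N) (dividedPower logPartitions⁺ K)
      ≡⟨ sumℚ-cong (suc N) (dividedPower-⊕ (harmonic N · monomial 0) logPartitions K) ⟩
    sumℚ (suc N) (binomialSum (harmonic N · monomial 0) logPartitions K)
      ≡⟨ sumℚ-cong (suc N) (λ n → sumℚ-cong (suc K) (λ k →
           dividedPower-constant-⋆ (harmonic N) (K ℕ.∸ k) (dividedPower logPartitions k) n)) ⟩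
    sumℚ (suc N) (λ n → sumℚ (suc K) (λ k → h (K ℕ.∸ k) * dividedPower logPartitions k n))
      ≡⟨ sumℚ-comm (suc N) (suc K) _ ⟩
    sumℚ (suc K) (λ k → sumℚ (suc N) (λ n → h (K ℕ.∸ k) * dividedPower logPartitions k n))
      ≡⟨ sumℚ-cong (suc K) (λ k → trans (sym (*-distribˡ-sumℚ (suc N) (h (K ℕ.∸ k)) _))
                                       (cong (h (K ℕ.∸ k) *_) (sym (*-distribˡ-sumℚ (suc N) (invFact k) _)))) ⟩
    sumℚ (suc K) (λ k → h (K ℕ.∸ k) * partitionSumTerm k) ∎
    where
    open ≡-Reasoning
    h : ℕ → ℚ
    h = expTerm (harmonic N)

  besselI0Partial-≤-expPartial-harmonic : ∀ K →
    besselI0Partial (zetaN2 N * ℕ→ℚ N) K ≤ expPartial K (harmonic N) * ℕ→ℚ (partitionSum N)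
  besselI0Partial-≤-expPartial-harmonic K = begin
    besselI0Partial (zetaN2 N * ℕ→ℚ N) K
      ≡⟨ besselI0Partial-as-coefficients K ⟩
    sumℚ K (λ k → invFact k * (expTerm (zetaN2 N) k * ℕ→ℚ (N ℕ.^ k)))
      ≤⟨ sumℚ-mono-≤ K
           (λ k _ → *-monoˡ-≤-0≤ (invFact-nonNeg k) (cumulative-logPartitions⁺^-≥ k N ℕP.≤-refl)) ⟩
    sumℚ K (λ k → invFact k * cumulative (logPartitions⁺ ⋆^ k) N)
      ≡⟨ sumℚ-cong K cumulative-logPartitions⁺^-binomial ⟩
    sumℚ K (λ k → sumℚ (suc k) (λ j → expTerm (harmonic N) (k ℕ.∸ j) * partitionSumTerm j))
      ≤⟨ sumℚ-convolution-≤ K (expTerm (harmonic N)) partitionSumTerm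
           (expTerm-nonNeg (harmonic-nonNeg N)) partitionSumTerm-nonNeg ⟩
    expPartial K (harmonic N) * sumℚ K partitionSumTerm
      ≤⟨ *-monoˡ-≤-0≤ (expPartial-nonNeg K (harmonic-nonNeg N)) (sumℚ-partitionSumTerm-≤ K) ⟩
    expPartial K (harmonic N) * ℕ→ℚ (partitionSum N) ∎
    where open ≤-Reasoning

mainTheorem1 : (N : ℕ) → .{{_ : NonZero N}} →
    ((K : ℕ) → (ε : ℚ) → 0ℚ < ε →
       ∃[ M ] (besselI0Partial (zetaN2 N * ℕ→ℚ N) K
                 ≤ (ePartial M * ℕ→ℚ N) * ℕ→ℚ (partitionSum N) + ε))
    ×
    ((ε : ℚ) → 0ℚ < ε →
       ∃[ K ] (ℕ→ℚ (partitionSum N) ≤ besselI0Partial (zetaN2 N * ℕ→ℚ N) K + ε))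
-- Both bounds hold with ε = 0, taking M = K for the first and K = N + 1 for the second.
mainTheorem1 N@(suc n) = lowerBound , upperBound
  where
  S : ℚ
  S = ℕ→ℚ (partitionSum N)
  lowerBound : ∀ K ε → 0ℚ < ε → ∃[ M ] (besselI0Partial (zetaN2 N * ℕ→ℚ N) K ≤ (ePartial M * ℕ→ℚ N) * S + ε)
  lowerBound K ε ε>0 = K , (begin
    besselI0Partial (zetaN2 N * ℕ→ℚ N) K
      ≤⟨ besselI0Partial-≤-expPartial-harmonic N K ⟩
    expPartial K (harmonic N) * S
      ≤⟨ *-monoʳ-≤-0≤ (ℕ→ℚ-nonNeg (partitionSum N)) (expPartial-harmonic-≤ K n) ⟩
    ePartial K * ℕ→ℚ N * S
      ≤⟨ p≤p+q (<⇒≤ ε>0) ⟩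
    ePartial K * ℕ→ℚ N * S + ε ∎)
    where open ≤-Reasoning
  upperBound : ∀ ε → 0ℚ < ε → ∃[ K ] (S ≤ besselI0Partial (zetaN2 N * ℕ→ℚ N) K + ε)
  upperBound ε ε>0 = suc N , ≤-trans (partitionSum≤besselI0Partial N) (p≤p+q (<⇒≤ ε>0))
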